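{- For $k\geq 3$, let $S_k^2$ be the spider with $k$ legs, each of length $2$. Then \[\mathrm{max}\text{ - }\overline{\mathrm{cr}}(S_k^2)=\binom{2k}{2}-2\binom{k}{2}-k+\left\lfloor\frac{k^2}{4}\right\rfloor.\]
   Context: A spider is a subdivision of the star $K_{1,k}$; each path from the degree-$k$ center vertex to a leaf is a leg, and the length of a leg is its number of edges. So $S_k^2$ is obtained from $K_{1,k}$ by subdividing every edge exactly once. A good drawing of a graph in the plane is one in which no edge crosses itself, any two edges share at most one point (counting endpoints), no three edges share a common interior crossing point, and edges do not contain vertices in their interior. A rectilinear drawing is a good drawing in which every edge is a straight line segment. The maximum rectilinear crossing number $\mathrm{max}\text{ - }\overline{\mathrm{cr}}(G)$ is the maximum number of crossings over all rectilinear drawings of $G$.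
   Formalization: The rectilinear drawings of $S_k^2$ place their vertices at points with rational coordinates rather than at arbitrary points of the real plane. -}

module Defs where

open import Data.Nat as ℕ using (ℕ; _∸_)
open import Data.Nat.DivMod using (_/_)
open import Data.Nat.Combinatorics using (_C_)
open import Data.Fin using (Fin; toℕ)
open import Data.Product using (Σ; Σ-syntax; _×_; _,_; proj₁; proj₂)
open import Data.Rational using (ℚ; 0ℚ; 1ℚ; _+_; _*_; _-_; _≤_; _<_)
open import Relation.Binary.PropositionalEquality using (_≡_)
open import Relation.Nullary using (¬_)

Point : Set
Point = ℚ × ℚ

along : Point → Point → ℚ → Point
along (ax , ay) (bx , by) t = (ax + t * (bx - ax)) , (ay + t * (by - ay))

OnSeg : Point → Point → Point → Set
OnSeg A B P = Σ[ t ∈ ℚ ] (0ℚ ≤ t × t ≤ 1ℚ × P ≡ along A B t)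

InSegInterior : Point → Point → Point → Set
InSegInterior A B P = Σ[ t ∈ ℚ ] (0ℚ < t × t < 1ℚ × P ≡ along A B t)

data Vertex (k : ℕ) : Set where
  center : Vertex k
  mid    : Fin k → Vertex k
  leaf   : Fin k → Vertex k

data Edge (k : ℕ) : Set where
  inner : Fin k → Edge k
  outer : Fin k → Edge k

src tgt : ∀ {k} → Edge k → Vertex k
src (inner i) = center
src (outer i) = mid i
tgt (inner i) = mid i
tgt (outer i) = leaf i

-- a numbering of the edges, used to speak of unordered pairs of edges
edgeCode : ∀ {k} → Edge k → ℕ
edgeCode (inner i) = toℕ i
edgeCode {k} (outer i) = k ℕ.+ toℕ i

record RectDrawing (k : ℕ) : Set where
  field
    pos : Vertex k → Point
    pos-injective : ∀ u v → pos u ≡ pos v → u ≡ v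
  OnEdge : Edge k → Point → Set
  OnEdge e = OnSeg (pos (src e)) (pos (tgt e))
  InEdgeInterior : Edge k → Point → Set
  InEdgeInterior e = InSegInterior (pos (src e)) (pos (tgt e))
  field
    no-vertex-inside : ∀ (e : Edge k) (v : Vertex k) → ¬ InEdgeInterior e (pos v)
    share-at-most-one : ∀ (e f : Edge k) → ¬ e ≡ f →
      ∀ P Q → OnEdge e P → OnEdge f P → OnEdge e Q → OnEdge f Q → P ≡ Q
    no-triple-crossing : ∀ (e f g : Edge k) → ¬ e ≡ f → ¬ e ≡ g → ¬ f ≡ g →
      ∀ P → InEdgeInterior e P → InEdgeInterior f P → ¬ InEdgeInterior g P
open RectDrawing public

-- A crossing of the drawing: an unordered pair of edges {e,f}
-- (represented with edgeCode e < edgeCode f) whose interiors meet.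
-- In a good drawing two edges cross at most once, so crossings
-- correspond to such pairs.
Crossing : ∀ {k} → RectDrawing k → Set
Crossing {k} D = Σ[ e ∈ Edge k ] Σ[ f ∈ Edge k ]
  (edgeCode e ℕ.< edgeCode f × Σ[ P ∈ Point ] (InEdgeInterior D e P × InEdgeInterior D f P))

crossingEdges : ∀ {k} (D : RectDrawing k) → Crossing D → Edge k × Edge k
crossingEdges D (e , f , _) = e , f

HasAtLeastCrossings : ∀ {k} → RectDrawing k → ℕ → Set
HasAtLeastCrossings D n = Σ[ c ∈ (Fin n → Crossing D) ]
  (∀ a b → crossingEdges D (c a) ≡ crossingEdges D (c b) → a ≡ b)

MaxRectCrossing : ℕ → ℕ → Set
MaxRectCrossing k N =
  Σ[ D ∈ RectDrawing k ] HasAtLeastCrossings D N ×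
  (∀ (D : RectDrawing k) (m : ℕ) → HasAtLeastCrossings D m → m ℕ.≤ N)

formula : ℕ → ℕ
formula k = ((((2 ℕ.* k) C 2) ∸ (2 ℕ.* (k C 2))) ∸ k) ℕ.+ ((k ℕ.* k) / 4)

-- Edges sharing a vertex cannot cross, so the only crossing
-- pairs are two outer edges, or the inner edge of a leg j with the outer edge
-- of another leg i.  A crossing of inner j with outer i forces leg i to turn,
-- at m i, towards the side of the line c m i that contains m j; hence if inner
-- j crosses outer i and inner i crosses outer j, the two legs turn in opposite
-- directions.  So each of the k(k-1)/2 pairs of legs carries at most two
-- crossings, plus a third only for one of the ≤ ⌊k²/4⌋ pairs made of a
-- left-turning and a right-turning leg: k(k-1) + ⌊k²/4⌋, which is the formula.
--
-- Put c at the origin and leg i at m i = (x i , 1),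
-- l i = (2 z i - x i , -1), with ⌊k/2⌋ legs on the right (x > 0 > z) and the
-- others mirrored on the left, using explicit integer parameters.  Then all
-- outer edges cross pairwise, inner j crosses outer i whenever j precedes i
-- and also whenever i is on the right and j on the left, and no three edges
-- pass through one point.

module Submission where

open import Defs
open import Data.Bool.Base using (Bool; true; false)
import Data.Bool.Properties as Bool
open import Data.Empty using (⊥; ⊥-elim)
open import Data.Fin.Base as Fin using (Fin; toℕ)
import Data.Fin.Properties as Fin
open import Data.List.Base using (_∷_; [])
open import Data.Maybe.Base using (Maybe; just; nothing)
open import Data.Nat.Base as ℕ using (ℕ; zero; suc; _∸_; ⌊_/2⌋; ⌈_/2⌉)
import Data.Nat.Properties as ℕ
import Data.Nat.Tactic.RingSolver as ℕ-Solver
open import Data.Product.Base using (∃-syntax; _×_; _,_; proj₁; proj₂; uncurry)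
open import Data.Rational.Base as ℚ using (ℚ; 0ℚ; 1ℚ; ½; 1/_)
import Data.Rational.Properties as ℚ
open import Data.Sum.Base using (_⊎_; inj₁; inj₂; [_,_]′)
open import Data.Sum.Properties using (inj₁-injective; inj₂-injective)
open import Function.Base using (_∘_)
open import Level using (0ℓ)
open import Relation.Binary.Definitions using (Tri; tri<; tri≈; tri>)
open import Relation.Binary.PropositionalEquality
open import Relation.Nullary using (¬_; Dec; yes; no; does)
open import Relation.Nullary.Decidable using (_×-dec_; dec-true; dec-false)
open import Relation.Unary using (Pred; Decidable)
import Tactic.RingSolver.Core.AlmostCommutativeRing as ACR
open import Tactic.RingSolver using (solve-∀; solve)

module ℚ-Lemmas where

  open import Data.Rational.Base using (_+_; _*_; _-_; -_; _≤_; _<_)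

  ringℚ : ACR.AlmostCommutativeRing _ _
  ringℚ = ACR.fromCommutativeRing ℚ.+-*-commutativeRing isZero
    where
    isZero : ∀ p → Maybe (0ℚ ≡ p)
    isZero p with 0ℚ ℚ.≟ p
    ... | yes 0≡p = just 0≡p
    ... | no _    = nothing

  private
    variable
      p q r s t : ℚ

  p<q⇒0<q-p : p < q → 0ℚ < q - p
  p<q⇒0<q-p {p} {q} p<q = subst (_< q - p) (ℚ.+-inverseʳ p) (ℚ.+-monoˡ-< (- p) p<q)

  q-p+p≡q : ∀ q p → q - p + p ≡ q
  q-p+p≡q = solve-∀ ringℚ

  0<q-p⇒p<q : 0ℚ < q - p → p < q
  0<q-p⇒p<q {q} {p} 0<q-p = subst₂ _<_ (ℚ.+-identityˡ p) (q-p+p≡q q p) (ℚ.+-monoˡ-< p 0<q-p)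

  p≤q⇒0≤q-p : p ≤ q → 0ℚ ≤ q - p
  p≤q⇒0≤q-p {p} {q} p≤q = subst (_≤ q - p) (ℚ.+-inverseʳ p) (ℚ.+-monoˡ-≤ (- p) p≤q)

  0≤q-p⇒p≤q : 0ℚ ≤ q - p → p ≤ q
  0≤q-p⇒p≤q {q} {p} 0≤q-p =
    subst₂ _≤_ (ℚ.+-identityˡ p) (q-p+p≡q q p) (ℚ.+-monoˡ-≤ p 0≤q-p)

  p<0⇒0<-p : p < 0ℚ → 0ℚ < - p
  p<0⇒0<-p = ℚ.neg-antimono-<

  0<-p⇒p<0 : 0ℚ < - p → p < 0ℚ
  0<-p⇒p<0 {p} 0<-p = subst (_< 0ℚ) (-‿involutive p) (ℚ.neg-antimono-< 0<-p)
    where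
    -‿involutive : ∀ p → - - p ≡ p
    -‿involutive = solve-∀ ringℚ

  +-pos : 0ℚ < p → 0ℚ < q → 0ℚ < p + q
  +-pos {p} {q} 0<p 0<q = subst (_< p + q) (ℚ.+-identityˡ 0ℚ) (ℚ.+-mono-< 0<p 0<q)

  +-pos-nonNeg : 0ℚ < p → 0ℚ ≤ q → 0ℚ < p + q
  +-pos-nonNeg {p} {q} 0<p 0≤q = subst (_< p + q) (ℚ.+-identityˡ 0ℚ) (ℚ.+-mono-<-≤ 0<p 0≤q)

  *-pos : 0ℚ < p → 0ℚ < q → 0ℚ < p * q
  *-pos {p} {q} 0<p 0<q =
    ℚ.positive⁻¹ (p * q) {{ℚ.pos*pos⇒pos p {{ℚ.positive 0<p}} q {{ℚ.positive 0<q}}}}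

  *-nonNeg : 0ℚ ≤ p → 0ℚ ≤ q → 0ℚ ≤ p * q
  *-nonNeg {p} {q} 0≤p 0≤q =
    ℚ.nonNegative⁻¹ (p * q) {{ℚ.nonNeg*nonNeg⇒nonNeg p {{ℚ.nonNegative 0≤p}} q {{ℚ.nonNegative 0≤q}}}}

  *-cancelʳ-pos : 0ℚ < q → 0ℚ < p * q → 0ℚ < p
  *-cancelʳ-pos {q} {p} 0<q 0<pq =
    ℚ.*-cancelʳ-<-nonNeg q {{ℚ.nonNegative (ℚ.<⇒≤ 0<q)}} (subst (_< p * q) (sym (ℚ.*-zeroˡ q)) 0<pq)

  pos⇒≢0 : 0ℚ < p → p ≢ 0ℚ
  pos⇒≢0 0<p p≡0 = ℚ.<-irrefl (sym p≡0) 0<p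

  p≢0⇒0<p*p : p ≢ 0ℚ → 0ℚ < p * p
  p≢0⇒0<p*p {p} p≢0 with ℚ.<-cmp p 0ℚ
  ... | tri< p<0 _ _ = subst (0ℚ <_) (-p*-p≡p*p p) (*-pos (p<0⇒0<-p p<0) (p<0⇒0<-p p<0))
    where
    -p*-p≡p*p : ∀ p → - p * - p ≡ p * p
    -p*-p≡p*p = solve-∀ ringℚ
  ... | tri≈ _ p≡0 _ = ⊥-elim (p≢0 p≡0)
  ... | tri> _ _ 0<p = *-pos 0<p 0<p

  0≤p*p : ∀ p → 0ℚ ≤ p * p
  0≤p*p p with p ℚ.≟ 0ℚ
  ... | yes refl = ℚ.≤-refl
  ... | no p≢0   = ℚ.<⇒≤ (p≢0⇒0<p*p p≢0)

  p-q≡0⇒p≡q : p - q ≡ 0ℚ → p ≡ q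
  p-q≡0⇒p≡q {p} {q} p-q≡0 = begin
    p           ≡⟨ solve (p ∷ q ∷ []) ringℚ ⟩
    (p - q) + q ≡⟨ cong (_+ q) p-q≡0 ⟩
    0ℚ + q      ≡⟨ ℚ.+-identityˡ q ⟩
    q           ∎
    where open ≡-Reasoning

  p≡q⇒p-q≡0 : p ≡ q → p - q ≡ 0ℚ
  p≡q⇒p-q≡0 {q = q} refl = ℚ.+-inverseʳ q

  p*q≡0⇒q≡0 : p ≢ 0ℚ → p * q ≡ 0ℚ → q ≡ 0ℚ
  p*q≡0⇒q≡0 {p} {q} p≢0 pq≡0 = begin
    q              ≡⟨ solve (q ∷ []) ringℚ ⟩
    1ℚ * q         ≡⟨ cong (_* q) (sym (ℚ.*-inverseˡ p)) ⟩
    1/ p * p * q   ≡⟨ ℚ.*-assoc (1/ p) p q ⟩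
    1/ p * (p * q) ≡⟨ cong (1/ p *_) pq≡0 ⟩
    1/ p * 0ℚ      ≡⟨ ℚ.*-zeroʳ (1/ p) ⟩
    0ℚ             ∎
    where
    open ≡-Reasoning
    instance _ = ℚ.≢-nonZero p≢0

  *-cancelˡ-≡ : p ≢ 0ℚ → p * q ≡ p * r → q ≡ r
  *-cancelˡ-≡ {p} {q} {r} p≢0 pq≡pr = p-q≡0⇒p≡q (p*q≡0⇒q≡0 p≢0 (begin
    p * (q - r)   ≡⟨ solve (p ∷ q ∷ r ∷ []) ringℚ ⟩
    p * q - p * r ≡⟨ p≡q⇒p-q≡0 pq≡pr ⟩
    0ℚ            ∎))
    where open ≡-Reasoning

  quotient : ∀ n d → d ≢ 0ℚ → ∃[ y ] y * d ≡ n
  quotient n d d≢0 = n * 1/ d , (begin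
    n * 1/ d * d   ≡⟨ ℚ.*-assoc n (1/ d) d ⟩
    n * (1/ d * d) ≡⟨ cong (n *_) (ℚ.*-inverseˡ d) ⟩
    n * 1ℚ         ≡⟨ ℚ.*-identityʳ n ⟩
    n              ∎)
    where
    open ≡-Reasoning
    instance _ = ℚ.≢-nonZero d≢0

  proper-fraction : ∀ {n d} → 0ℚ < n → n < d → ∃[ y ] (0ℚ < y × y < 1ℚ × y * d ≡ n)
  proper-fraction {n} {d} 0<n n<d = y , 0<y , y<1 , yd≡n
    where
    0<d = ℚ.<-trans 0<n n<d
    y = proj₁ (quotient n d (pos⇒≢0 0<d))
    yd≡n = proj₂ (quotient n d (pos⇒≢0 0<d))
    0<y = *-cancelʳ-pos 0<d (subst (0ℚ <_) (sym yd≡n) 0<n)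
    y<1 = ℚ.*-cancelʳ-<-nonNeg d {{ℚ.nonNegative (ℚ.<⇒≤ 0<d)}}
            (subst₂ _<_ (sym yd≡n) (sym (ℚ.*-identityˡ d)) n<d)

  s*p≡t*q⇒0<q⇒0<p : 0ℚ < s → 0ℚ < t → s * p ≡ t * q → 0ℚ < q → 0ℚ < p
  s*p≡t*q⇒0<q⇒0<p {s} {t} {p} {q} 0<s 0<t sp≡tq 0<q =
    *-cancelʳ-pos 0<s (subst (0ℚ <_) (trans (sym sp≡tq) (ℚ.*-comm s p)) (*-pos 0<t 0<q))

  s*p≡t*q⇒q<0⇒p<0 : 0ℚ < s → 0ℚ < t → s * p ≡ t * q → q < 0ℚ → p < 0ℚ
  s*p≡t*q⇒q<0⇒p<0 {s} {t} {p} {q} 0<s 0<t sp≡tq q<0 =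
    0<-p⇒p<0 (s*p≡t*q⇒0<q⇒0<p 0<s 0<t (negate sp≡tq) (p<0⇒0<-p q<0))
    where
    negate : s * p ≡ t * q → s * - p ≡ t * - q
    negate sp≡tq = trans (sym (ℚ.neg-distribʳ-* s p)) (trans (cong -_ sp≡tq) (ℚ.neg-distribʳ-* t q))

  ι : ℕ → ℚ
  ι zero    = 0ℚ
  ι (suc n) = 1ℚ + ι n

  ι-+ : ∀ m n → ι (m ℕ.+ n) ≡ ι m + ι n
  ι-+ zero    n = sym (ℚ.+-identityˡ (ι n))
  ι-+ (suc m) n = trans (cong (1ℚ +_) (ι-+ m n)) (sym (ℚ.+-assoc 1ℚ (ι m) (ι n)))

  ι-* : ∀ m n → ι (m ℕ.* n) ≡ ι m * ι n
  ι-* zero    n = sym (ℚ.*-zeroˡ (ι n))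
  ι-* (suc m) n = trans (ι-+ n (m ℕ.* n)) (trans (cong (ι n +_) (ι-* m n)) (distrib (ι n) (ι m)))
    where
    distrib : ∀ a b → a + b * a ≡ (1ℚ + b) * a
    distrib = solve-∀ ringℚ

  0≤ι : ∀ n → 0ℚ ≤ ι n
  0≤ι zero    = ℚ.≤-refl
  0≤ι (suc n) = ℚ.<⇒≤ (+-pos-nonNeg (ℚ.positive⁻¹ 1ℚ) (0≤ι n))

  m<n⇒0<ιn-ιm : ∀ {m n} → m ℕ.< n → 0ℚ < ι n - ι m
  m<n⇒0<ιn-ιm {m} (ℕ.s≤s m≤n′) with o , refl ← ℕ.m≤n⇒∃[o]m+o≡n m≤n′ =
    subst (0ℚ <_) (sym difference) (+-pos-nonNeg (ℚ.positive⁻¹ 1ℚ) (0≤ι o))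
    where
    cancel : ∀ a b → (1ℚ + (a + b)) - a ≡ 1ℚ + b
    cancel = solve-∀ ringℚ
    difference : ι (suc (m ℕ.+ o)) - ι m ≡ 1ℚ + ι o
    difference = trans (cong (λ x → (1ℚ + x) - ι m) (ι-+ m o)) (cancel (ι m) (ι o))

  ι-mono-< : ∀ {m n} → m ℕ.< n → ι m < ι n
  ι-mono-< = 0<q-p⇒p<q ∘ m<n⇒0<ιn-ιm

  0<ι : ∀ {n} → 0 ℕ.< n → 0ℚ < ι n
  0<ι = ι-mono-<

  ι-injective : ∀ {m n} → ι m ≡ ι n → m ≡ n
  ι-injective {m} {n} ιm≡ιn with ℕ.<-cmp m n
  ... | tri< m<n _ _ = ⊥-elim (ℚ.<-irrefl ιm≡ιn (ι-mono-< m<n))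
  ... | tri≈ _ m≡n _ = m≡n
  ... | tri> _ _ n<m = ⊥-elim (ℚ.<-irrefl (sym ιm≡ιn) (ι-mono-< n<m))

  p+q≡r⇒p≡r-q : p + q ≡ r → p ≡ r - q
  p+q≡r⇒p≡r-q {p} {q} refl = sym (p+q-q≡p p q)
    where
    p+q-q≡p : ∀ p q → p + q - q ≡ p
    p+q-q≡p = solve-∀ ringℚ

  convex-zero⇒t<0 : 0ℚ < p * q → t < 1ℚ → (1ℚ - t) * p + t * q ≡ 0ℚ → t < 0ℚ
  convex-zero⇒t<0 {p} {q} {t} 0<pq t<1 eq with t ℚ.<? 0ℚ
  ... | yes t<0 = t<0
  ... | no t≮0  = ⊥-elim (pos⇒≢0 positive (begin
    (1ℚ - t) * (p * q) + t * (q * q)  ≡⟨ expand p q t ⟩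
    q * ((1ℚ - t) * p + t * q)        ≡⟨ cong (q *_) eq ⟩
    q * 0ℚ                            ≡⟨ ℚ.*-zeroʳ q ⟩
    0ℚ                                ∎))
    where
    open ≡-Reasoning
    expand : ∀ p q t → (1ℚ - t) * (p * q) + t * (q * q) ≡ q * ((1ℚ - t) * p + t * q)
    expand = solve-∀ ringℚ
    positive : 0ℚ < (1ℚ - t) * (p * q) + t * (q * q)
    positive = +-pos-nonNeg (*-pos (p<q⇒0<q-p t<1) 0<pq) (*-nonNeg (ℚ.≮⇒≥ t≮0) (0≤p*p q))

  convex-zero⇒0<t : p * q < 0ℚ → t < 1ℚ → (1ℚ - t) * p + t * q ≡ 0ℚ → 0ℚ < t
  convex-zero⇒0<t {p} {q} {t} pq<0 t<1 eq with 0ℚ ℚ.<? t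
  ... | yes 0<t = 0<t
  ... | no 0≮t  = ⊥-elim (pos⇒≢0 positive (begin
    (1ℚ - t) * - (p * q) + (0ℚ - t) * (q * q)  ≡⟨ expand p q t ⟩
    - (q * ((1ℚ - t) * p + t * q))             ≡⟨ cong (λ r → - (q * r)) eq ⟩
    - (q * 0ℚ)                                 ≡⟨ cong -_ (ℚ.*-zeroʳ q) ⟩
    0ℚ                                         ∎))
    where
    open ≡-Reasoning
    expand : ∀ p q t → (1ℚ - t) * - (p * q) + (0ℚ - t) * (q * q) ≡ - (q * ((1ℚ - t) * p + t * q))
    expand = solve-∀ ringℚ
    positive : 0ℚ < (1ℚ - t) * - (p * q) + (0ℚ - t) * (q * q)
    positive = +-pos-nonNeg (*-pos (p<q⇒0<q-p t<1) (p<0⇒0<-p pq<0)) (*-nonNeg (p≤q⇒0≤q-p (ℚ.≮⇒≥ 0≮t)) (0≤p*p q))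

module Segments where

  open import Data.Rational.Base using (_+_; _*_; _-_; -_; _≤_; _<_)

  open ℚ-Lemmas

  cross : Point → Point → Point → Point → ℚ
  cross (ax , ay) (bx , by) (cx , cy) (dx , dy) = (bx - ax) * (dy - cy) - (by - ay) * (dx - cx)

  interior⇒onSeg : ∀ A B {P} → InSegInterior A B P → OnSeg A B P
  interior⇒onSeg A B (t , 0<t , t<1 , P≡) = t , ℚ.<⇒≤ 0<t , ℚ.<⇒≤ t<1 , P≡

  start-onSeg : ∀ A B → OnSeg A B A
  start-onSeg (ax , ay) (bx , by) =
    0ℚ , ℚ.≤-refl , ℚ.<⇒≤ (ℚ.positive⁻¹ 1ℚ) , cong₂ _,_ (a≡a+0[b-a] ax bx) (a≡a+0[b-a] ay by)
    where
    a≡a+0[b-a] : ∀ a b → a ≡ a + 0ℚ * (b - a)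
    a≡a+0[b-a] = solve-∀ ringℚ

  end-onSeg : ∀ A B → OnSeg A B B
  end-onSeg (ax , ay) (bx , by) =
    1ℚ , ℚ.<⇒≤ (ℚ.positive⁻¹ 1ℚ) , ℚ.≤-refl , cong₂ _,_ (b≡a+1[b-a] ax bx) (b≡a+1[b-a] ay by)
    where
    b≡a+1[b-a] : ∀ a b → b ≡ a + 1ℚ * (b - a)
    b≡a+1[b-a] = solve-∀ ringℚ

  -- Subtracting the two parametrisations of AB and of CD and taking the
  -- cross product with D - C gives (t₁ - t₂) · cross A B C D = 0.
  nonParallel⇒meet-at-most-once : ∀ A B C D → cross A B C D ≢ 0ℚ → ∀ P Q →
    OnSeg A B P → OnSeg C D P → OnSeg A B Q → OnSeg C D Q → P ≡ Q
  nonParallel⇒meet-at-most-once A@(ax , ay) B@(bx , by) (cx , cy) (dx , dy) nonParallel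
    (px , py) (qx , qy) (t₁ , _ , _ , P≡AB) (s₁ , _ , _ , P≡CD) (t₂ , _ , _ , Q≡AB) (s₂ , _ , _ , Q≡CD) =
    begin
      (px , py)     ≡⟨ P≡AB ⟩
      along A B t₁  ≡⟨ cong (along A B) t₁≡t₂ ⟩
      along A B t₂  ≡⟨ Q≡AB ⟨
      (qx , qy)     ∎
    where
    open ≡-Reasoning
    ⟨_,_⟩×DC : ℚ → ℚ → ℚ
    ⟨ x , y ⟩×DC = x * (dy - cy) - y * (dx - cx)
    lhs : ∀ ax ay bx by cx cy dx dy t₁ t₂ →
      (t₁ - t₂) * ((bx - ax) * (dy - cy) - (by - ay) * (dx - cx)) ≡
      ((ax + t₁ * (bx - ax)) - (ax + t₂ * (bx - ax))) * (dy - cy) - ((ay + t₁ * (by - ay)) - (ay + t₂ * (by - ay))) * (dx - cx)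
    lhs = solve-∀ ringℚ
    rhs : ∀ cx cy dx dy s₁ s₂ →
      ((cx + s₁ * (dx - cx)) - (cx + s₂ * (dx - cx))) * (dy - cy) - ((cy + s₁ * (dy - cy)) - (cy + s₂ * (dy - cy))) * (dx - cx) ≡ 0ℚ
    rhs = solve-∀ ringℚ
    [t₁-t₂]·cross≡0 : (t₁ - t₂) * cross A B (cx , cy) (dx , dy) ≡ 0ℚ
    [t₁-t₂]·cross≡0 = begin
      (t₁ - t₂) * cross A B (cx , cy) (dx , dy)               ≡⟨ lhs ax ay bx by cx cy dx dy t₁ t₂ ⟩
      ⟨ proj₁ (along A B t₁) - proj₁ (along A B t₂) , proj₂ (along A B t₁) - proj₂ (along A B t₂) ⟩×DC
        ≡⟨ cong₂ ⟨_,_⟩×DC (cong₂ _-_ (cong proj₁ (sym P≡AB)) (cong proj₁ (sym Q≡AB)))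
                          (cong₂ _-_ (cong proj₂ (sym P≡AB)) (cong proj₂ (sym Q≡AB))) ⟩
      ⟨ px - qx , py - qy ⟩×DC
        ≡⟨ cong₂ ⟨_,_⟩×DC (cong₂ _-_ (cong proj₁ P≡CD) (cong proj₁ Q≡CD))
                          (cong₂ _-_ (cong proj₂ P≡CD) (cong proj₂ Q≡CD)) ⟩
      ⟨ (cx + s₁ * (dx - cx)) - (cx + s₂ * (dx - cx)) , (cy + s₁ * (dy - cy)) - (cy + s₂ * (dy - cy)) ⟩×DC
        ≡⟨ rhs cx cy dx dy s₁ s₂ ⟩
      0ℚ ∎
    t₁≡t₂ : t₁ ≡ t₂
    t₁≡t₂ = p-q≡0⇒p≡q (p*q≡0⇒q≡0 nonParallel (trans (ℚ.*-comm _ (t₁ - t₂)) [t₁-t₂]·cross≡0))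

  -- Both sides equal the cross product of C M with C P.
  cross-at-meeting : ∀ C M L E {P} s t → P ≡ along M L s → P ≡ along C E t →
    s * cross C M M L ≡ t * cross C M C E
  cross-at-meeting (cx , cy) (mx , my) (lx , ly) (ex , ey) {px , py} s t P≡ML P≡CE = begin
    s * ((mx - cx) * (ly - my) - (my - cy) * (lx - mx))  ≡⟨ lhs cx cy mx my lx ly s ⟩
    CM× (mx + s * (lx - mx)) (my + s * (ly - my))        ≡⟨ cong₂ CM× (cong proj₁ (sym P≡ML)) (cong proj₂ (sym P≡ML)) ⟩
    CM× px py                                            ≡⟨ cong₂ CM× (cong proj₁ P≡CE) (cong proj₂ P≡CE) ⟩
    CM× (cx + t * (ex - cx)) (cy + t * (ey - cy))        ≡⟨ rhs cx cy mx my ex ey t ⟩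
    t * ((mx - cx) * (ey - cy) - (my - cy) * (ex - cx))  ∎
    where
    open ≡-Reasoning
    CM× : ℚ → ℚ → ℚ
    CM× px py = (mx - cx) * (py - cy) - (my - cy) * (px - cx)
    lhs : ∀ cx cy mx my lx ly s → s * ((mx - cx) * (ly - my) - (my - cy) * (lx - mx)) ≡
      (mx - cx) * ((my + s * (ly - my)) - cy) - (my - cy) * ((mx + s * (lx - mx)) - cx)
    lhs = solve-∀ ringℚ
    rhs : ∀ cx cy mx my ex ey t → (mx - cx) * ((cy + t * (ey - cy)) - cy) - (my - cy) * ((cx + t * (ex - cx)) - cx) ≡
      t * ((mx - cx) * (ey - cy) - (my - cy) * (ex - cx))
    rhs = solve-∀ ringℚ

  parallel⇒projection : ∀ ux uy wx wy → ux * wy - uy * wx ≡ 0ℚ →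
    (ux * ux + uy * uy) * wx ≡ (ux * wx + uy * wy) * ux × (ux * ux + uy * uy) * wy ≡ (ux * wx + uy * wy) * uy
  parallel⇒projection ux uy wx wy u×w≡0 =
    trans (first ux uy wx wy) (trans (cong (λ z → β * ux - uy * z) u×w≡0) (first-0 β ux uy)) ,
    trans (second ux uy wx wy) (trans (cong (λ z → β * uy + ux * z) u×w≡0) (second-0 β ux uy))
    where
    β = ux * wx + uy * wy
    first : ∀ ux uy wx wy → (ux * ux + uy * uy) * wx ≡ (ux * wx + uy * wy) * ux - uy * (ux * wy - uy * wx)
    first = solve-∀ ringℚ
    second : ∀ ux uy wx wy → (ux * ux + uy * uy) * wy ≡ (ux * wx + uy * wy) * uy + ux * (ux * wy - uy * wx)
    second = solve-∀ ringℚ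
    first-0 : ∀ b ux uy → b * ux - uy * 0ℚ ≡ b * ux
    first-0 = solve-∀ ringℚ
    second-0 : ∀ b ux uy → b * uy + ux * 0ℚ ≡ b * uy
    second-0 = solve-∀ ringℚ

  scaled-difference⇒along : ∀ A B Q μ {a b} → a ≢ 0ℚ → μ * a ≡ b →
    a * (proj₁ Q - proj₁ A) ≡ b * (proj₁ B - proj₁ A) →
    a * (proj₂ Q - proj₂ A) ≡ b * (proj₂ B - proj₂ A) → Q ≡ along A B μ
  scaled-difference⇒along (ax , ay) (bx , by) (qx , qy) μ a≢0 μa≡b eqx eqy =
    cong₂ _,_ (coordinate ax bx qx μ a≢0 μa≡b eqx) (coordinate ay by qy μ a≢0 μa≡b eqy)
    where
    coordinate : ∀ x y q μ {a b} → a ≢ 0ℚ → μ * a ≡ b → a * (q - x) ≡ b * (y - x) → q ≡ x + μ * (y - x)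
    coordinate x y q μ {a} a≢0 refl eq = *-cancelˡ-≡ a≢0 (begin
      a * q                     ≡⟨ solve (a ∷ q ∷ x ∷ []) ringℚ ⟩
      a * (q - x) + a * x       ≡⟨ cong (_+ a * x) eq ⟩
      μ * a * (y - x) + a * x   ≡⟨ solve (a ∷ μ ∷ x ∷ y ∷ []) ringℚ ⟩
      a * (x + μ * (y - x))     ∎)
      where open ≡-Reasoning

  -- Everything lies on the line through C with direction u = M - C, and a
  -- point is located by its projection onto u: C ↦ 0, M ↦ α = u·u,
  -- E ↦ β = u·(E - C), and P ↦ α + s δ = t β where δ = u·(L - M).
  module CollinearMeeting (C M L E : Point) (M≢C : M ≢ C) (CME≡0 : cross C M C E ≡ 0ℚ)
    {P s t} (0<s : 0ℚ < s) (s<1 : s < 1ℚ) (0<t : 0ℚ < t) (P≡ML : P ≡ along M L s) (P≡CE : P ≡ along C E t) where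

    ux = proj₁ M - proj₁ C
    uy = proj₂ M - proj₂ C
    dx = proj₁ L - proj₁ M
    dy = proj₂ L - proj₂ M
    wx = proj₁ E - proj₁ C
    wy = proj₂ E - proj₂ C
    α = ux * ux + uy * uy
    β = ux * wx + uy * wy
    δ = ux * dx + uy * dy

    0<α : 0ℚ < α
    0<α with ux ℚ.≟ 0ℚ | uy ℚ.≟ 0ℚ
    ... | no ux≢0  | _        = +-pos-nonNeg (p≢0⇒0<p*p ux≢0) (0≤p*p uy)
    ... | yes _    | no uy≢0  = subst (0ℚ <_) (ℚ.+-comm (uy * uy) (ux * ux)) (+-pos-nonNeg (p≢0⇒0<p*p uy≢0) (0≤p*p ux))
    ... | yes ux≡0 | yes uy≡0 = ⊥-elim (M≢C (cong₂ _,_ (p-q≡0⇒p≡q ux≡0) (p-q≡0⇒p≡q uy≡0)))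

    u×d≡0 : ux * dy - uy * dx ≡ 0ℚ
    u×d≡0 = p*q≡0⇒q≡0 (pos⇒≢0 0<s)
      (trans (cross-at-meeting C M L E s t P≡ML P≡CE) (trans (cong (t *_) CME≡0) (ℚ.*-zeroʳ t)))

    αw≡βu = parallel⇒projection ux uy wx wy CME≡0
    αd≡δu = parallel⇒projection ux uy dx dy u×d≡0

    α+sδ≡tβ : α + s * δ ≡ t * β
    α+sδ≡tβ = begin
      α + s * δ                                ≡⟨ expand ux uy dx dy s ⟩
      ux * (ux + s * dx) + uy * (uy + s * dy)
        ≡⟨ cong₂ (λ a b → ux * a + uy * b)
             (coordinate (proj₁ C) (proj₁ M) (proj₁ L) (proj₁ E) (cong proj₁ P≡ML) (cong proj₁ P≡CE))
             (coordinate (proj₂ C) (proj₂ M) (proj₂ L) (proj₂ E) (cong proj₂ P≡ML) (cong proj₂ P≡CE)) ⟩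
      ux * (t * wx) + uy * (t * wy)            ≡⟨ collect ux uy wx wy t ⟩
      t * β                                    ∎
      where
      open ≡-Reasoning
      coordinate : ∀ c m l e {p} → p ≡ m + s * (l - m) → p ≡ c + t * (e - c) → (m - c) + s * (l - m) ≡ t * (e - c)
      coordinate c m l e p≡ml p≡ce = begin
        (m - c) + s * (l - m)  ≡⟨ solve (m ∷ c ∷ s ∷ l ∷ []) ringℚ ⟩
        (m + s * (l - m)) - c  ≡⟨ cong (_- c) (trans (sym p≡ml) p≡ce) ⟩
        (c + t * (e - c)) - c  ≡⟨ solve (c ∷ t ∷ e ∷ []) ringℚ ⟩
        t * (e - c)            ∎
      expand : ∀ ux uy dx dy s → (ux * ux + uy * uy) + s * (ux * dx + uy * dy) ≡ ux * (ux + s * dx) + uy * (uy + s * dy)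
      expand = solve-∀ ringℚ
      collect : ∀ ux uy wx wy t → ux * (t * wx) + uy * (t * wy) ≡ t * (ux * wx + uy * wy)
      collect = solve-∀ ringℚ

    C-inside-ML : β ≤ 0ℚ → InSegInterior M L C
    C-inside-ML β≤0 = inside (proper-fraction 0<α α<-δ)
      where
      α≤s*-δ : α ≤ s * - δ
      α≤s*-δ = 0≤q-p⇒p≤q (subst (0ℚ ≤_) (rearrange α s δ)
        (p≤q⇒0≤q-p (subst₂ _≤_ (sym α+sδ≡tβ) (ℚ.*-zeroʳ t)
          (ℚ.*-monoˡ-≤-nonNeg t {{ℚ.nonNegative (ℚ.<⇒≤ 0<t)}} β≤0))))
        where
        rearrange : ∀ α s δ → 0ℚ - (α + s * δ) ≡ s * - δ - α
        rearrange = solve-∀ ringℚ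
      0<-δ : 0ℚ < - δ
      0<-δ = *-cancelʳ-pos 0<s (subst (0ℚ <_) (ℚ.*-comm s (- δ)) (ℚ.<-≤-trans 0<α α≤s*-δ))
      α<-δ : α < - δ
      α<-δ = ℚ.≤-<-trans α≤s*-δ (subst (s * - δ <_) (ℚ.*-identityˡ (- δ)) (ℚ.*-monoˡ-<-pos (- δ) {{ℚ.positive 0<-δ}} s<1))
      flip : ∀ δ c m → - δ * (c - m) ≡ δ * (m - c)
      flip = solve-∀ ringℚ
      inside : ∃[ σ ] (0ℚ < σ × σ < 1ℚ × σ * - δ ≡ α) → InSegInterior M L C
      inside (σ , 0<σ , σ<1 , σ[-δ]≡α) = σ , 0<σ , σ<1 , scaled-difference⇒along M L C σ (pos⇒≢0 0<-δ) σ[-δ]≡α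
        (trans (flip δ (proj₁ C) (proj₁ M)) (sym (proj₁ αd≡δu))) (trans (flip δ (proj₂ C) (proj₂ M)) (sym (proj₂ αd≡δu)))

    E-inside-CM : 0ℚ < β → β < α → InSegInterior C M E
    E-inside-CM 0<β β<α with μ , 0<μ , μ<1 , μα≡β ← proper-fraction 0<β β<α =
      μ , 0<μ , μ<1 , scaled-difference⇒along C M E μ (pos⇒≢0 0<α) μα≡β (proj₁ αw≡βu) (proj₂ αw≡βu)

    M≡E : β ≡ α → M ≡ E
    M≡E β≡α = trans (proj₂ (proj₂ (proj₂ (end-onSeg C M))))
      (sym (scaled-difference⇒along C M E 1ℚ (pos⇒≢0 0<α) (trans (ℚ.*-identityˡ α) (sym β≡α))
        (proj₁ αw≡βu) (proj₂ αw≡βu)))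

    M-inside-CE : α < β → InSegInterior C E M
    M-inside-CE α<β with ν , 0<ν , ν<1 , νβ≡α ← proper-fraction 0<α α<β =
      ν , 0<ν , ν<1 , scaled-difference⇒along C E M ν (pos⇒≢0 (ℚ.<-trans 0<α α<β)) νβ≡α
        (sym (proj₁ αw≡βu)) (sym (proj₂ αw≡βu))

    position : InSegInterior C M E ⊎ InSegInterior C E M ⊎ M ≡ E ⊎ InSegInterior M L C
    position with ℚ.<-cmp 0ℚ β | ℚ.<-cmp β α
    ... | tri> _ _ β<0 | _              = inj₂ (inj₂ (inj₂ (C-inside-ML (ℚ.<⇒≤ β<0))))
    ... | tri≈ _ 0≡β _ | _              = inj₂ (inj₂ (inj₂ (C-inside-ML (ℚ.≤-reflexive (sym 0≡β)))))
    ... | tri< 0<β _ _ | tri< β<α _ _   = inj₁ (E-inside-CM 0<β β<α)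
    ... | tri< _ _ _   | tri≈ _ β≡α _   = inj₂ (inj₂ (inj₁ (M≡E β≡α)))
    ... | tri< _ _ _   | tri> _ _ α<β   = inj₂ (inj₁ (M-inside-CE α<β))

  collinear-meeting : ∀ C M L E → M ≢ C → cross C M C E ≡ 0ℚ → ∀ {P} →
    InSegInterior M L P → InSegInterior C E P →
    InSegInterior C M E ⊎ InSegInterior C E M ⊎ M ≡ E ⊎ InSegInterior M L C
  collinear-meeting C M L E M≢C CME≡0 (s , 0<s , s<1 , P≡ML) (t , 0<t , _ , P≡CE) =
    CollinearMeeting.position C M L E M≢C CME≡0 0<s s<1 0<t P≡ML P≡CE

  cross-swap : ∀ C A B → cross C B C A ≡ - cross C A C B
  cross-swap (cx , cy) (ax , ay) (bx , by) = swap cx cy ax ay bx by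
    where
    swap : ∀ cx cy ax ay bx by →
      (bx - cx) * (ay - cy) - (by - cy) * (ax - cx) ≡ - ((ax - cx) * (by - cy) - (ay - cy) * (bx - cx))
    swap = solve-∀ ringℚ

module Counting where

  open import Data.Nat.Base using (_+_; _≤_; z≤n; s≤s)

  count : ∀ {n} {P : Pred (Fin n) 0ℓ} → Decidable P → ℕ
  count {zero} P? = 0
  count {suc n} P? with P? Fin.zero
  ... | yes _ = suc (count (P? ∘ Fin.suc))
  ... | no _  = count (P? ∘ Fin.suc)

  rank : ∀ {n} {P : Pred (Fin n) 0ℓ} (P? : Decidable P) i → P i → Fin (count P?)
  rank {suc n} P? i Pi with P? Fin.zero | i
  ... | yes _  | Fin.zero  = Fin.zero
  ... | no ¬P0 | Fin.zero  = ⊥-elim (¬P0 Pi)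
  ... | yes _  | Fin.suc i = Fin.suc (rank (P? ∘ Fin.suc) i Pi)
  ... | no _   | Fin.suc i = rank (P? ∘ Fin.suc) i Pi

  rank-injective : ∀ {n} {P : Pred (Fin n) 0ℓ} (P? : Decidable P) {i j} (Pi : P i) (Pj : P j) →
    rank P? i Pi ≡ rank P? j Pj → i ≡ j
  rank-injective {suc n} P? {i} {j} Pi Pj eq with P? Fin.zero | i | j
  ... | yes _ | Fin.zero  | Fin.zero  = refl
  ... | yes _ | Fin.suc i | Fin.suc j = cong Fin.suc (rank-injective (P? ∘ Fin.suc) Pi Pj (Fin.suc-injective eq))
  ... | no _  | Fin.suc i | Fin.suc j = cong Fin.suc (rank-injective (P? ∘ Fin.suc) Pi Pj eq)
  ... | no ¬P0 | Fin.zero | _ = ⊥-elim (¬P0 Pi)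
  ... | no ¬P0 | Fin.suc _ | Fin.zero = ⊥-elim (¬P0 Pj)
  ... | yes _ | Fin.zero  | Fin.suc _ with () ← eq
  ... | yes _ | Fin.suc _ | Fin.zero  with () ← eq

  count-disjoint : ∀ {n} {P Q : Pred (Fin n) 0ℓ} (P? : Decidable P) (Q? : Decidable Q) →
    (∀ i → P i → Q i → ⊥) → count P? + count Q? ≤ n
  count-disjoint {zero} P? Q? disjoint = z≤n
  count-disjoint {suc n} P? Q? disjoint with P? Fin.zero | Q? Fin.zero
      | count-disjoint (P? ∘ Fin.suc) (Q? ∘ Fin.suc) (disjoint ∘ Fin.suc)
  ... | yes P0 | yes Q0 | _ = ⊥-elim (disjoint Fin.zero P0 Q0)
  ... | yes _  | no _   | ih = s≤s ih
  ... | no _   | yes _  | ih = subst (_≤ suc n) (sym (ℕ.+-suc _ _)) (s≤s ih)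
  ... | no _   | no _   | ih = ℕ.m≤n⇒m≤1+n ih

  splitAt-injective : ∀ m {n} (a b : Fin (m + n)) → Fin.splitAt m a ≡ Fin.splitAt m b → a ≡ b
  splitAt-injective m {n} a b eq =
    trans (sym (Fin.join-splitAt m n a)) (trans (cong (Fin.join m n) eq) (Fin.join-splitAt m n b))

  join-injective : ∀ m n (s t : Fin m ⊎ Fin n) → Fin.join m n s ≡ Fin.join m n t → s ≡ t
  join-injective m n s t eq =
    trans (sym (Fin.splitAt-join m n s)) (trans (cong (Fin.splitAt m) eq) (Fin.splitAt-join m n t))

  remQuot-injective : ∀ {m} n (a b : Fin (m ℕ.* n)) → Fin.remQuot {m} n a ≡ Fin.remQuot n b → a ≡ b
  remQuot-injective {m} n a b eq =
    trans (sym (Fin.combine-remQuot {m} n a)) (trans (cong (uncurry Fin.combine) eq) (Fin.combine-remQuot {m} n b))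

module Arithmetic where

  open import Data.Nat.Base using (_+_; _*_; _≤_; _<_; z≤n; s≤s)
  open import Data.Nat.Combinatorics using (_C_; nC1≡n; nCk+nC[k+1]≡[n+1]C[k+1])
  open import Data.Nat.DivMod using (_/_; m*n/n≡m; /-monoˡ-≤; m<n*o⇒m/o<n)

  2*nC2+n≡n*n : ∀ n → 2 * (n C 2) + n ≡ n * n
  2*nC2+n≡n*n zero = refl
  2*nC2+n≡n*n (suc n) = begin
    2 * (suc n C 2) + suc n          ≡⟨ cong (λ c → 2 * c + suc n) (nCk+nC[k+1]≡[n+1]C[k+1] n 1) ⟨
    2 * (n C 1 + n C 2) + suc n      ≡⟨ cong (λ c → 2 * (c + n C 2) + suc n) (nC1≡n n) ⟩
    2 * (n + n C 2) + suc n          ≡⟨ regroup n (n C 2) ⟩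
    suc (2 * n) + (2 * (n C 2) + n)  ≡⟨ cong (suc (2 * n) +_) (2*nC2+n≡n*n n) ⟩
    suc (2 * n) + n * n              ≡⟨ ℕ-Solver.solve (n ∷ []) ⟩
    suc n * suc n                    ∎
    where
    open ≡-Reasoning
    regroup : ∀ n c → 2 * (n + c) + suc n ≡ suc (2 * n) + (2 * c + n)
    regroup = ℕ-Solver.solve-∀

  [2n]C2≡n*n+2*nC2 : ∀ n → (2 * n) C 2 ≡ n * n + 2 * (n C 2)
  [2n]C2≡n*n+2*nC2 n = ℕ.*-cancelˡ-≡ _ _ 2 (ℕ.+-cancelʳ-≡ (2 * n) _ _ (begin
    2 * ((2 * n) C 2) + 2 * n              ≡⟨ 2*nC2+n≡n*n (2 * n) ⟩
    (2 * n) * (2 * n)                      ≡⟨ ℕ-Solver.solve (n ∷ []) ⟩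
    2 * (n * n) + 2 * (n * n)              ≡⟨ cong (λ m → 2 * (n * n) + 2 * m) (2*nC2+n≡n*n n) ⟨
    2 * (n * n) + 2 * (2 * (n C 2) + n)    ≡⟨ regroup n (n C 2) ⟩
    2 * (n * n + 2 * (n C 2)) + 2 * n      ∎))
    where
    open ≡-Reasoning
    regroup : ∀ n c → 2 * (n * n) + 2 * (2 * c + n) ≡ 2 * (n * n + 2 * c) + 2 * n
    regroup = ℕ-Solver.solve-∀

  formula≡k*[k∸1]+k²/4 : ∀ k → formula k ≡ k * (k ∸ 1) + k * k / 4
  formula≡k*[k∸1]+k²/4 k = cong (_+ k * k / 4) (begin
    ((2 * k) C 2 ∸ 2 * (k C 2)) ∸ k            ≡⟨ cong (λ c → (c ∸ 2 * (k C 2)) ∸ k) ([2n]C2≡n*n+2*nC2 k) ⟩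
    (k * k + 2 * (k C 2) ∸ 2 * (k C 2)) ∸ k    ≡⟨ cong (_∸ k) (ℕ.m+n∸n≡m (k * k) (2 * (k C 2))) ⟩
    k * k ∸ k                                  ≡⟨ cong (k * k ∸_) (ℕ.*-identityʳ k) ⟨
    k * k ∸ k * 1                              ≡⟨ ℕ.*-distribˡ-∸ k k 1 ⟨
    k * (k ∸ 1)                                ∎)
    where open ≡-Reasoning

  4mn≤[m+n]² : ∀ m n → 4 * (m * n) ≤ (m + n) * (m + n)
  4mn≤[m+n]² m n with ℕ.≤-total m n
  ... | inj₁ m≤n with d , refl ← ℕ.m≤n⇒∃[o]m+o≡n m≤n =
    subst (4 * (m * (m + d)) ≤_) (sym (square m d)) (ℕ.m≤m+n _ (d * d))
    where
    square : ∀ m d → (m + (m + d)) * (m + (m + d)) ≡ 4 * (m * (m + d)) + d * d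
    square = ℕ-Solver.solve-∀
  ... | inj₂ n≤m with d , refl ← ℕ.m≤n⇒∃[o]m+o≡n n≤m =
    subst (4 * ((n + d) * n) ≤_) (sym (square n d)) (ℕ.m≤m+n _ (d * d))
    where
    square : ∀ n d → ((n + d) + n) * ((n + d) + n) ≡ 4 * ((n + d) * n) + d * d
    square = ℕ-Solver.solve-∀

  m+n≤k⇒m*n≤k²/4 : ∀ {m n k} → m + n ≤ k → m * n ≤ k * k / 4
  m+n≤k⇒m*n≤k²/4 {m} {n} {k} m+n≤k =
    subst (_≤ k * k / 4) (trans (cong (_/ 4) (ℕ.*-comm 4 (m * n))) (m*n/n≡m (m * n) 4))
      (/-monoˡ-≤ 4 (ℕ.≤-trans (4mn≤[m+n]² m n) (ℕ.*-mono-≤ m+n≤k m+n≤k)))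

  k²<[1+⌊k/2⌋*⌈k/2⌉]*4 : ∀ k → k * k < suc (⌊ k /2⌋ * ⌈ k /2⌉) * 4
  k²<[1+⌊k/2⌋*⌈k/2⌉]*4 0 = s≤s z≤n
  k²<[1+⌊k/2⌋*⌈k/2⌉]*4 1 = s≤s (s≤s z≤n)
  k²<[1+⌊k/2⌋*⌈k/2⌉]*4 (suc (suc k)) = begin-strict
    suc (suc k) * suc (suc k)        ≡⟨ ℕ-Solver.solve (k ∷ []) ⟩
    k * k + 4 * suc k                <⟨ ℕ.+-monoˡ-< (4 * suc k) (k²<[1+⌊k/2⌋*⌈k/2⌉]*4 k) ⟩
    suc (a * b) * 4 + 4 * suc k      ≡⟨ cong (λ n → suc (a * b) * 4 + 4 * suc n) (ℕ.⌊n/2⌋+⌈n/2⌉≡n k) ⟨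
    suc (a * b) * 4 + 4 * suc (a + b) ≡⟨ expand a b ⟩
    suc (suc a * suc b) * 4          ∎
    where
    open ℕ.≤-Reasoning
    a = ⌊ k /2⌋
    b = ⌈ k /2⌉
    expand : ∀ a b → suc (a * b) * 4 + 4 * suc (a + b) ≡ suc (suc a * suc b) * 4
    expand = ℕ-Solver.solve-∀

  k²/4≤⌊k/2⌋*[k∸⌊k/2⌋] : ∀ k → k * k / 4 ≤ ⌊ k /2⌋ * (k ∸ ⌊ k /2⌋)
  k²/4≤⌊k/2⌋*[k∸⌊k/2⌋] k = subst (λ b → k * k / 4 ≤ ⌊ k /2⌋ * b) (sym k∸⌊k/2⌋≡⌈k/2⌉)
    (ℕ.<⇒≤pred (m<n*o⇒m/o<n (k²<[1+⌊k/2⌋*⌈k/2⌉]*4 k)))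
    where
    k∸⌊k/2⌋≡⌈k/2⌉ : k ∸ ⌊ k /2⌋ ≡ ⌈ k /2⌉
    k∸⌊k/2⌋≡⌈k/2⌉ = trans (cong (_∸ ⌊ k /2⌋) (sym (ℕ.⌊n/2⌋+⌈n/2⌉≡n k))) (ℕ.m+n∸m≡n ⌊ k /2⌋ ⌈ k /2⌉)

module OrderedPairs {k′ : ℕ} where

  open import Data.Nat.Base using (_*_; _<_)

  private
    k = suc k′

  pair-code : (a b : Fin k) → a ≢ b → Fin (k * k′)
  pair-code a b a≢b = Fin.combine a (Fin.punchOut a≢b)

  pair-code-injective : ∀ {a b a′ b′} (a≢b : a ≢ b) (a′≢b′ : a′ ≢ b′) →
    pair-code a b a≢b ≡ pair-code a′ b′ a′≢b′ → a ≡ a′ × b ≡ b′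
  pair-code-injective {a} {b} {a′} {b′} a≢b a′≢b′ eq
    with refl , punchOut≡ ← Fin.combine-injective a (Fin.punchOut a≢b) a′ (Fin.punchOut a′≢b′) eq =
    refl , Fin.punchOut-injective a≢b a′≢b′ punchOut≡

  descending-code : (a b : Fin k) → a ≢ b → Fin (k * k′)
  descending-code a b a≢b with toℕ b ℕ.<? toℕ a
  ... | yes _ = pair-code a b a≢b
  ... | no _  = pair-code b a (a≢b ∘ sym)

  pair-code≢descending-code : ∀ {a b a′ b′} (a<b : toℕ a < toℕ b) (a′≢b′ : a′ ≢ b′) →
    pair-code a b (Fin.<⇒≢ a<b) ≢ descending-code a′ b′ a′≢b′
  pair-code≢descending-code {a} {b} {a′} {b′} a<b a′≢b′ eq with toℕ b′ ℕ.<? toℕ a′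
  ... | yes b′<a′ with refl , refl ← pair-code-injective (Fin.<⇒≢ a<b) a′≢b′ eq = ℕ.<-asym a<b b′<a′
  ... | no b′≮a′  with refl , refl ← pair-code-injective (Fin.<⇒≢ a<b) (a′≢b′ ∘ sym) eq = b′≮a′ a<b

  descending-code-injective : ∀ {a b a′ b′} (a≢b : a ≢ b) (a′≢b′ : a′ ≢ b′) →
    descending-code a b a≢b ≡ descending-code a′ b′ a′≢b′ → (a ≡ a′ × b ≡ b′) ⊎ (a ≡ b′ × b ≡ a′)
  descending-code-injective {a} {b} {a′} {b′} a≢b a′≢b′ eq with toℕ b ℕ.<? toℕ a | toℕ b′ ℕ.<? toℕ a′
  ... | yes _ | yes _ = inj₁ (pair-code-injective a≢b a′≢b′ eq)
  ... | no _  | no _  with refl , refl ← pair-code-injective (a≢b ∘ sym) (a′≢b′ ∘ sym) eq = inj₁ (refl , refl)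
  ... | yes _ | no _  with refl , refl ← pair-code-injective a≢b (a′≢b′ ∘ sym) eq = inj₂ (refl , refl)
  ... | no _  | yes _ with refl , refl ← pair-code-injective (a≢b ∘ sym) a′≢b′ eq = inj₂ (refl , refl)

module UpperBound {k′ : ℕ} (D : RectDrawing (suc k′)) where

  open import Data.Rational.Base using (_+_; _*_; _-_; -_; _≤_; _<_)

  open ℚ-Lemmas
  open Segments
  open Counting
  open OrderedPairs

  private
    k = suc k′

  c : Point
  c = pos D center

  m l : Fin k → Point
  m i = pos D (mid i)
  l i = pos D (leaf i)

  turn : Fin k → ℚ
  turn i = cross c (m i) (m i) (l i)

  TurnsLeft TurnsRight : Pred (Fin k) 0ℓ
  TurnsLeft i = 0ℚ < turn i
  TurnsRight i = turn i < 0ℚ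

  data InnerMeetsOuter (j i : Fin k) : Set where
    meet : ∀ {P} → InEdgeInterior D (inner j) P → InEdgeInterior D (outer i) P → InnerMeetsOuter j i

  common-endpoint⇒no-crossing : ∀ e f v → e ≢ f → OnEdge D e (pos D v) → OnEdge D f (pos D v) →
    ∀ P → InEdgeInterior D e P → InEdgeInterior D f P → ⊥
  common-endpoint⇒no-crossing e f v e≢f e∋v f∋v P e∋P f∋P =
    no-vertex-inside D e v (subst (InEdgeInterior D e) P≡v e∋P)
    where
    P≡v : P ≡ pos D v
    P≡v = share-at-most-one D e f e≢f P (pos D v)
      (interior⇒onSeg (pos D (src e)) (pos D (tgt e)) e∋P) (interior⇒onSeg (pos D (src f)) (pos D (tgt f)) f∋P) e∋v f∋v

  inner-inner-no-crossing : ∀ {i j} → i ≢ j → ∀ P → InEdgeInterior D (inner i) P → InEdgeInterior D (inner j) P → ⊥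
  inner-inner-no-crossing {i} {j} i≢j = common-endpoint⇒no-crossing (inner i) (inner j) center
    (λ { refl → i≢j refl }) (start-onSeg c (m i)) (start-onSeg c (m j))

  inner-outer-same-leg-no-crossing : ∀ i P → InEdgeInterior D (inner i) P → InEdgeInterior D (outer i) P → ⊥
  inner-outer-same-leg-no-crossing i = common-endpoint⇒no-crossing (inner i) (outer i) (mid i)
    (λ ()) (end-onSeg c (m i)) (start-onSeg (m i) (l i))

  meeting⇒turn-relation : ∀ {j i} → InnerMeetsOuter j i →
    ∃[ s ] ∃[ t ] (0ℚ < s × 0ℚ < t × s * turn i ≡ t * cross c (m i) c (m j))
  meeting⇒turn-relation {j} {i} (meet (t , 0<t , _ , P≡inner) (s , 0<s , _ , P≡outer)) =
    s , t , 0<s , 0<t , cross-at-meeting c (m i) (l i) (m j) s t P≡outer P≡inner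

  meeting⇒non-collinear : ∀ {j i} → i ≢ j → InnerMeetsOuter j i → cross c (m i) c (m j) ≢ 0ℚ
  meeting⇒non-collinear {j} {i} i≢j (meet inner∋P outer∋P) collinear
    with collinear-meeting c (m i) (l i) (m j) (λ eq → mid≢center (pos-injective D (mid i) center eq)) collinear outer∋P inner∋P
    where
    mid≢center : mid i ≢ center
    mid≢center ()
  ... | inj₁ inner-i∋mj                = no-vertex-inside D (inner i) (mid j) inner-i∋mj
  ... | inj₂ (inj₁ inner-j∋mi)         = no-vertex-inside D (inner j) (mid i) inner-j∋mi
  ... | inj₂ (inj₂ (inj₁ mi≡mj))       with refl ← pos-injective D (mid i) (mid j) mi≡mj = i≢j refl
  ... | inj₂ (inj₂ (inj₂ outer-i∋c))   = no-vertex-inside D (outer i) center outer-i∋c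

  -- Both relations involve cross c (m i) c (m j), with opposite signs.
  mutual-meeting⇒opposite-turns : ∀ {i j} → i ≢ j → InnerMeetsOuter j i → InnerMeetsOuter i j →
    TurnsLeft i × TurnsRight j ⊎ TurnsLeft j × TurnsRight i
  mutual-meeting⇒opposite-turns {i} {j} i≢j ji ij = by-sign (ℚ.<-cmp 0ℚ spread) (meeting⇒turn-relation {j} {i} ji) relation-j
    where
    spread : ℚ
    spread = cross c (m i) c (m j)
    relation-j : ∃[ s ] ∃[ t ] (0ℚ < s × 0ℚ < t × s * turn j ≡ t * - spread)
    relation-j = negate (meeting⇒turn-relation {i} {j} ij)
      where
      negate : ∃[ s ] ∃[ t ] (0ℚ < s × 0ℚ < t × s * turn j ≡ t * cross c (m j) c (m i)) →
               ∃[ s ] ∃[ t ] (0ℚ < s × 0ℚ < t × s * turn j ≡ t * - spread)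
      negate (s , t , 0<s , 0<t , rel) = s , t , 0<s , 0<t , trans rel (cong (t *_) (cross-swap c (m i) (m j)))
    by-sign : Tri (0ℚ < spread) (0ℚ ≡ spread) (spread < 0ℚ) →
      ∃[ s ] ∃[ t ] (0ℚ < s × 0ℚ < t × s * turn i ≡ t * spread) →
      ∃[ s ] ∃[ t ] (0ℚ < s × 0ℚ < t × s * turn j ≡ t * - spread) →
      TurnsLeft i × TurnsRight j ⊎ TurnsLeft j × TurnsRight i
    by-sign (tri< 0<spread _ _) (s , t , 0<s , 0<t , rel-i) (s′ , t′ , 0<s′ , 0<t′ , rel-j) =
      inj₁ (s*p≡t*q⇒0<q⇒0<p 0<s 0<t rel-i 0<spread , s*p≡t*q⇒q<0⇒p<0 0<s′ 0<t′ rel-j (ℚ.neg-antimono-< 0<spread))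
    by-sign (tri≈ _ 0≡spread _) _ _ = ⊥-elim (meeting⇒non-collinear {j} {i} i≢j ji (sym 0≡spread))
    by-sign (tri> _ _ spread<0) (s , t , 0<s , 0<t , rel-i) (s′ , t′ , 0<s′ , 0<t′ , rel-j) =
      inj₂ (s*p≡t*q⇒0<q⇒0<p 0<s′ 0<t′ rel-j (p<0⇒0<-p spread<0) , s*p≡t*q⇒q<0⇒p<0 0<s 0<t rel-i spread<0)

  data CrossingType (x : Crossing D) : Set where
    outer-outer : ∀ i j → toℕ i ℕ.< toℕ j → crossingEdges D x ≡ (outer i , outer j) → CrossingType x
    inner-outer : ∀ j i → i ≢ j → InnerMeetsOuter j i → crossingEdges D x ≡ (inner j , outer i) → CrossingType x

  classify : ∀ x → CrossingType x
  classify (inner i , inner j , i<j , P , i∋P , j∋P) =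
    ⊥-elim (inner-inner-no-crossing (Fin.<⇒≢ i<j) P i∋P j∋P)
  classify (inner j , outer i , _ , P , j∋P , i∋P) with i Fin.≟ j
  ... | yes refl = ⊥-elim (inner-outer-same-leg-no-crossing i P j∋P i∋P)
  ... | no i≢j   = inner-outer j i i≢j (meet j∋P i∋P) refl
  classify (outer i , inner j , k+i<j , _) =
    ⊥-elim (ℕ.<-asym (ℕ.<-≤-trans (Fin.toℕ<n j) (ℕ.m≤m+n k (toℕ i))) k+i<j)
  classify (outer i , outer j , k+i<k+j , _) = outer-outer i j (ℕ.+-cancelˡ-< k _ _ k+i<k+j) refl

  TurnsLeft? : ∀ i → Dec (TurnsLeft i)
  TurnsLeft? i = 0ℚ ℚ.<? turn i

  TurnsRight? : ∀ i → Dec (TurnsRight i)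
  TurnsRight? i = turn i ℚ.<? 0ℚ

  -- A pair {i, j} carries at most three crossings: outer–outer coded by the
  -- ascending pair, one inner–outer by the descending pair, and a second
  -- inner–outer only when the legs turn in opposite directions.
  Code : Set
  Code = Fin (k ℕ.* k′) ⊎ Fin (count TurnsLeft? ℕ.* count TurnsRight?)

  inner-outer-code : ∀ j i → i ≢ j → Dec (TurnsLeft i × TurnsRight j) → Code
  inner-outer-code j i _   (yes (left , right)) = inj₂ (Fin.combine (rank TurnsLeft? i left) (rank TurnsRight? j right))
  inner-outer-code j i i≢j (no _)               = inj₁ (descending-code i j i≢j)

  code : ∀ {x} → CrossingType x → Code
  code (outer-outer i j i<j _)   = inj₁ (pair-code i j (Fin.<⇒≢ i<j))
  code (inner-outer j i i≢j _ _) = inner-outer-code j i i≢j (TurnsLeft? i ×-dec TurnsRight? j)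

  pair-code≢inner-outer-code : ∀ {i j j′ i′} (i<j : toℕ i ℕ.< toℕ j) (i′≢j′ : i′ ≢ j′) d →
    inj₁ (pair-code i j (Fin.<⇒≢ i<j)) ≢ inner-outer-code j′ i′ i′≢j′ d
  pair-code≢inner-outer-code i<j i′≢j′ (yes _) ()
  pair-code≢inner-outer-code i<j i′≢j′ (no _) eq = pair-code≢descending-code i<j i′≢j′ (inj₁-injective eq)

  inner-outer-code-injective : ∀ {j i j′ i′} (i≢j : i ≢ j) (i′≢j′ : i′ ≢ j′) →
    InnerMeetsOuter j i → InnerMeetsOuter j′ i′ → ∀ d d′ →
    inner-outer-code j i i≢j d ≡ inner-outer-code j′ i′ i′≢j′ d′ → j ≡ j′ × i ≡ i′
  inner-outer-code-injective {j} {i} {j′} {i′} _ _ _ _ (yes (left , right)) (yes (left′ , right′)) eq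
    with Fin.combine-injective _ _ _ _ (inj₂-injective eq)
  ... | rank-i≡ , rank-j≡ =
    rank-injective TurnsRight? {j} {j′} right right′ rank-j≡ , rank-injective TurnsLeft? {i} {i′} left left′ rank-i≡
  inner-outer-code-injective i≢j i′≢j′ ji j′i′ (no ¬LR) (no ¬L′R′) eq
    with descending-code-injective i≢j i′≢j′ (inj₁-injective eq)
  ... | inj₁ (refl , refl) = refl , refl
  ... | inj₂ (refl , refl) = ⊥-elim ([ ¬LR , ¬L′R′ ]′ (mutual-meeting⇒opposite-turns i≢j ji j′i′))

  code-injective : ∀ {x y} (tx : CrossingType x) (ty : CrossingType y) →
    code tx ≡ code ty → crossingEdges D x ≡ crossingEdges D y
  code-injective (outer-outer i j i<j x≡) (outer-outer i′ j′ i′<j′ y≡) eq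
    with refl , refl ← pair-code-injective (Fin.<⇒≢ i<j) (Fin.<⇒≢ i′<j′) (inj₁-injective eq) = trans x≡ (sym y≡)
  code-injective (outer-outer i j i<j _) (inner-outer j′ i′ i′≢j′ _ _) eq =
    ⊥-elim (pair-code≢inner-outer-code i<j i′≢j′ _ eq)
  code-injective (inner-outer j i i≢j _ _) (outer-outer i′ j′ i′<j′ _) eq =
    ⊥-elim (pair-code≢inner-outer-code i′<j′ i≢j _ (sym eq))
  code-injective (inner-outer j i i≢j ji x≡) (inner-outer j′ i′ i′≢j′ j′i′ y≡) eq
    with refl , refl ← inner-outer-code-injective i≢j i′≢j′ ji j′i′ _ _ eq = trans x≡ (sym y≡)

  crossings≤formula : ∀ n → HasAtLeastCrossings D n → n ℕ.≤ formula k
  crossings≤formula n (crossing , distinct) = ℕ.≤-trans (Fin.injective⇒≤ encode-injective) codes≤formula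
    where
    encode : Fin n → Fin (k ℕ.* k′ ℕ.+ count TurnsLeft? ℕ.* count TurnsRight?)
    encode a = Fin.join _ _ (code (classify (crossing a)))
    encode-injective : ∀ {a b} → encode a ≡ encode b → a ≡ b
    encode-injective {a} {b} eq = distinct a b (code-injective (classify (crossing a)) (classify (crossing b))
      (join-injective _ _ _ _ eq))
    codes≤formula : k ℕ.* k′ ℕ.+ count TurnsLeft? ℕ.* count TurnsRight? ℕ.≤ formula k
    codes≤formula = subst (k ℕ.* k′ ℕ.+ count TurnsLeft? ℕ.* count TurnsRight? ℕ.≤_) (sym (Arithmetic.formula≡k*[k∸1]+k²/4 k))
      (ℕ.+-monoʳ-≤ (k ℕ.* k′) (Arithmetic.m+n≤k⇒m*n≤k²/4 {count TurnsLeft?} {count TurnsRight?} {k}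
        (count-disjoint TurnsLeft? TurnsRight? (λ _ left right → ℚ.<-asym left right))))

-- Leg a (a < k) of either side gets |x| = X a and |z| = ζ a.  Consecutive X
-- differ by V, which exceeds every ζ and every 2(a + b), while all ζ lie in
-- (k², 2k²]; these are the facts the non-degeneracy proofs use.
module Parameters (k : ℕ) where

  open import Data.Nat.Base using (_+_; _*_; _≤_; _<_; z≤n; s≤s)

  Z V W : ℕ
  Z = 2 * (k * k)
  V = suc (Z + 4 * k)
  W = V * k

  X ζ : ℕ → ℕ
  X a = W + V * a
  ζ a = Z ∸ a * a

  private
    a²<k² : ∀ {a} → a < k → a * a < k * k
    a²<k² a<k = ℕ.*-mono-< a<k a<k

    a²≤Z : ∀ {a} → a < k → a * a ≤ Z
    a²≤Z a<k = ℕ.≤-trans (ℕ.<⇒≤ (a²<k² a<k)) (ℕ.m≤m+n (k * k) (k * k + 0))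

  ζ+a²≡Z : ∀ {a} → a < k → ζ a + a * a ≡ Z
  ζ+a²≡Z a<k = ℕ.m∸n+n≡m (a²≤Z a<k)

  0<ζ : ∀ {a} → a < k → 0 < ζ a
  0<ζ a<k = ℕ.m<n⇒0<n∸m (ℕ.<-≤-trans (a²<k² a<k) (ℕ.m≤m+n (k * k) (k * k + 0)))

  ζ<V : ∀ a → ζ a < V
  ζ<V a = s≤s (ℕ.≤-trans (ℕ.m∸n≤m Z (a * a)) (ℕ.m≤m+n Z (4 * k)))

  ζ≤2ζ : ∀ {a b} → a < k → ζ b ≤ 2 * ζ a
  ζ≤2ζ {a} {b} a<k = ℕ.≤-trans (ℕ.m∸n≤m Z (b * b)) (begin
    Z            ≡⟨ ζ+a²≡Z a<k ⟨
    ζ a + a * a  ≤⟨ ℕ.+-monoʳ-≤ (ζ a) a²≤ζ ⟩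
    ζ a + ζ a    ≡⟨ cong (ζ a +_) (ℕ.+-identityʳ (ζ a)) ⟨
    2 * ζ a      ∎)
    where
    open ℕ.≤-Reasoning
    a²≤ζ : a * a ≤ ζ a
    a²≤ζ = ℕ.m+n≤o⇒m≤o∸n (a * a)
      (subst (_≤ Z) (cong (a * a +_) (ℕ.+-identityʳ (a * a))) (ℕ.*-monoʳ-≤ 2 (ℕ.<⇒≤ (a²<k² a<k))))

  W≤X : ∀ a → W ≤ X a
  W≤X a = ℕ.m≤m+n W (V * a)

  0<X : ∀ {a} → a < k → 0 < X a
  0<X {a} a<k = ℕ.<-≤-trans (ℕ.*-mono-< {0} {V} {0} {k} (s≤s z≤n) (ℕ.≤-<-trans z≤n a<k)) (W≤X a)

  X<2W : ∀ {a} → a < k → X a < W + W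
  X<2W a<k = ℕ.+-monoʳ-< W (ℕ.*-monoʳ-< V a<k)

  X-mono : ∀ {a b} → a < b → X a < X b
  X-mono a<b = ℕ.+-monoʳ-< W (ℕ.*-monoʳ-< V a<b)

  X-injective : ∀ {a b} → X a ≡ X b → a ≡ b
  X-injective {a} {b} eq = ℕ.*-cancelˡ-≡ a b V (ℕ.+-cancelˡ-≡ W _ _ eq)

  2[a+b]<V : ∀ {a b} → a < k → b < k → 2 * (a + b) < V
  2[a+b]<V {a} {b} a<k b<k = s≤s (ℕ.≤-trans (ℕ.*-monoʳ-≤ 2 (ℕ.+-mono-≤ (ℕ.<⇒≤ a<k) (ℕ.<⇒≤ b<k)))
    (subst (_≤ Z + 4 * k) (4k≡2[k+k] k) (ℕ.m≤n+m (4 * k) Z)))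
    where
    4k≡2[k+k] : ∀ k → 4 * k ≡ 2 * (k + k)
    4k≡2[k+k] = ℕ-Solver.solve-∀

  a+b<V : ∀ {a b} → a < k → b < k → a + b < V
  a+b<V {a} {b} a<k b<k = ℕ.≤-<-trans (ℕ.m≤m+n (a + b) (a + b + 0)) (2[a+b]<V a<k b<k)

  X≢X+ζ : ∀ {a b} → b < k → X a ≢ X b + ζ b
  X≢X+ζ {a} {b} b<k eq with ℕ.<-cmp a b
  ... | tri< a<b _ _ = ℕ.<-irrefl eq (ℕ.<-≤-trans (X-mono a<b) (ℕ.m≤m+n (X b) (ζ b)))
  ... | tri≈ _ refl _ = ℕ.<-irrefl (ℕ.+-cancelˡ-≡ (X a) 0 (ζ a) (trans (ℕ.+-identityʳ (X a)) eq)) (0<ζ b<k)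
  ... | tri> _ _ b<a = ℕ.<-irrefl (sym eq) (ℕ.<-≤-trans (ℕ.+-monoʳ-< (X b) (ζ<V b)) (X-step b<a))
    where
    X-step : ∀ {b a} → b < a → X b + V ≤ X a
    X-step {b} {a} b<a with d , refl ← ℕ.m≤n⇒∃[o]m+o≡n b<a =
      subst (X b + V ≤_) (regroup W V b d) (ℕ.m≤m+n (X b + V) (V * d))
      where
      regroup : ∀ W V b d → W + V * b + V + V * d ≡ W + V * (suc b + d)
      regroup = ℕ-Solver.solve-∀

  X*ζ-gap : ∀ {a b} j → a < k → b < k → X a * ζ b < X j * ζ b + X j * ζ a + X b * ζ a
  X*ζ-gap {a} {b} j a<k b<k = begin-strict
    X a * ζ b                          <⟨ ℕ.*-monoˡ-< (ζ b) {{ℕ.>-nonZero (0<ζ b<k)}} (X<2W a<k) ⟩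
    (W + W) * ζ b                      ≡⟨ ℕ.*-distribʳ-+ (ζ b) W W ⟩
    W * ζ b + W * ζ b                  ≤⟨ ℕ.+-monoʳ-≤ (W * ζ b) (ℕ.*-monoʳ-≤ W (ζ≤2ζ {a} {b} a<k)) ⟩
    W * ζ b + W * (2 * ζ a)            ≡⟨ regroup W (ζ b) (ζ a) ⟩
    W * ζ b + W * ζ a + W * ζ a        ≤⟨ ℕ.+-mono-≤ (ℕ.+-mono-≤ (ℕ.*-monoˡ-≤ (ζ b) (W≤X j)) (ℕ.*-monoˡ-≤ (ζ a) (W≤X j)))
                                                    (ℕ.*-monoˡ-≤ (ζ a) (W≤X b)) ⟩
    X j * ζ b + X j * ζ a + X b * ζ a  ∎
    where
    open ℕ.≤-Reasoning
    regroup : ∀ w β α → w * β + w * (2 * α) ≡ w * β + w * α + w * α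
    regroup = ℕ-Solver.solve-∀

module Coordinates (k : ℕ) where

  open import Data.Rational.Base using (_+_; _*_; _-_; -_; _≤_; _<_)

  open Parameters k
  open ℚ-Lemmas

  sign : Bool → ℚ
  sign true  = 1ℚ
  sign false = - 1ℚ

  sign≢0 : ∀ g → sign g ≢ 0ℚ
  sign≢0 true  ()
  sign≢0 false ()

  sign-flip : ∀ {g g′} → g ≢ g′ → sign g′ ≡ - sign g
  sign-flip {true}  {true}  g≢g′ = ⊥-elim (g≢g′ refl)
  sign-flip {true}  {false} _    = refl
  sign-flip {false} {true}  _    = refl
  sign-flip {false} {false} g≢g′ = ⊥-elim (g≢g′ refl)

  sign-cancel : ∀ g {p q} → sign g * p ≡ sign g * q → p ≡ q
  sign-cancel g = *-cancelˡ-≡ (sign≢0 g)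

  sign-opposite : ∀ {g g′ p q} → g ≢ g′ → sign g * p ≡ sign g′ * q → p + q ≡ 0ℚ
  sign-opposite {g} {g′} {p} {q} g≢g′ eq = p*q≡0⇒q≡0 (sign≢0 g) (begin
    sign g * (p + q)           ≡⟨ ℚ.*-distribˡ-+ (sign g) p q ⟩
    sign g * p + sign g * q    ≡⟨ cong (_+ sign g * q) eq ⟩
    sign g′ * q + sign g * q   ≡⟨ cong (λ s → s * q + sign g * q) (sign-flip g≢g′) ⟩
    - sign g * q + sign g * q  ≡⟨ cancel (sign g) q ⟩
    0ℚ                         ∎)
    where
    open ≡-Reasoning
    cancel : ∀ s q → - s * q + s * q ≡ 0ℚ
    cancel = solve-∀ ringℚ

  X̂ ζ̂ : ℕ → ℚ
  X̂ a = ι (X a)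
  ζ̂ a = ι (ζ a)

  0<X̂ : ∀ {a} → a ℕ.< k → 0ℚ < X̂ a
  0<X̂ a<k = 0<ι (0<X a<k)

  0<ζ̂ : ∀ {a} → a ℕ.< k → 0ℚ < ζ̂ a
  0<ζ̂ a<k = 0<ι (0<ζ a<k)

  X̂-expand : ∀ a → X̂ a ≡ ι W + ι V * ι a
  X̂-expand a = trans (ι-+ W (V ℕ.* a)) (cong (ι W +_) (ι-* V a))

  ζ̂-expand : ∀ {a} → a ℕ.< k → ζ̂ a ≡ ι Z - ι a * ι a
  ζ̂-expand {a} a<k = p+q≡r⇒p≡r-q (begin
    ζ̂ a + ι a * ι a     ≡⟨ cong (ζ̂ a +_) (ι-* a a) ⟨
    ζ̂ a + ι (a ℕ.* a)   ≡⟨ ι-+ (ζ a) (a ℕ.* a) ⟨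
    ι (ζ a ℕ.+ a ℕ.* a) ≡⟨ cong ι (ζ+a²≡Z a<k) ⟩
    ι Z                 ∎)
    where open ≡-Reasoning

  -- Leg a on side g has middle vertex (x g a , 1), and its outer edge
  -- crosses the horizontal axis at z g a.
  x z : Bool → ℕ → ℚ
  x g a = sign g * X̂ a
  z g a = - sign g * ζ̂ a

  x-injective : ∀ {g g′ a b} → a ℕ.< k → b ℕ.< k → x g a ≡ x g′ b → g ≡ g′ × a ≡ b
  x-injective {g} {g′} {a} {b} a<k b<k eq with g Bool.≟ g′
  ... | yes refl = refl , X-injective (ι-injective (sign-cancel g eq))
  ... | no g≢g′  = ⊥-elim (pos⇒≢0 (+-pos (0<X̂ a<k) (0<X̂ b<k)) (sign-opposite g≢g′ eq))

  z≢0 : ∀ g {a} → a ℕ.< k → z g a ≢ 0ℚ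
  z≢0 true  a<k z≡0 = pos⇒≢0 (0<ζ̂ a<k) (p*q≡0⇒q≡0 (sign≢0 false) z≡0)
  z≢0 false a<k z≡0 = pos⇒≢0 (0<ζ̂ a<k) (p*q≡0⇒q≡0 (sign≢0 true) z≡0)

  x-z≡ : ∀ g a → x g a - z g a ≡ sign g * (X̂ a + ζ̂ a)
  x-z≡ g a = expand (sign g) (X̂ a) (ζ̂ a)
    where
    expand : ∀ s X ζ → s * X - (- s * ζ) ≡ s * (X + ζ)
    expand = solve-∀ ringℚ

  0<ιV-ιa-ιb : ∀ {a b} → a ℕ.< k → b ℕ.< k → 0ℚ < ι V - ι a - ι b
  0<ιV-ιa-ιb {a} {b} a<k b<k = subst (0ℚ <_) (trans (cong (λ s → ι V - s) (ι-+ a b)) (regroup (ι V) (ι a) (ι b)))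
    (m<n⇒0<ιn-ιm (a+b<V a<k b<k))
    where
    regroup : ∀ v a b → v - (a + b) ≡ v - a - b
    regroup = solve-∀ ringℚ

  x-z-injective : ∀ {g g′ a b} → a ℕ.< k → b ℕ.< k → x g a - z g a ≡ x g′ b - z g′ b → g ≡ g′ × a ≡ b
  x-z-injective {g} {g′} {a} {b} a<k b<k eq with g Bool.≟ g′
  ... | yes refl = refl , ι-injective (p-q≡0⇒p≡q (p*q≡0⇒q≡0 (pos⇒≢0 (0<ιV-ιa-ιb a<k b<k)) (begin
    (ι V - ι a - ι b) * (ι a - ι b)       ≡⟨ factor (ι V) (ι W) (ι Z) (ι a) (ι b) ⟩
    (ι W + ι V * ι a + (ι Z - ι a * ι a)) - (ι W + ι V * ι b + (ι Z - ι b * ι b))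
      ≡⟨ cong₂ (λ p q → p - q) (cong₂ _+_ (X̂-expand a) (ζ̂-expand a<k)) (cong₂ _+_ (X̂-expand b) (ζ̂-expand b<k)) ⟨
    (X̂ a + ζ̂ a) - (X̂ b + ζ̂ b)             ≡⟨ p≡q⇒p-q≡0 (sign-cancel g (trans (sym (x-z≡ g a)) (trans eq (x-z≡ g b)))) ⟩
    0ℚ                                     ∎)))
    where
    open ≡-Reasoning
    factor : ∀ V W Z a b → (V - a - b) * (a - b) ≡ (W + V * a + (Z - a * a)) - (W + V * b + (Z - b * b))
    factor = solve-∀ ringℚ
  ... | no g≢g′ = ⊥-elim (pos⇒≢0 (+-pos (+-pos (0<X̂ a<k) (0<ζ̂ a<k)) (+-pos (0<X̂ b<k) (0<ζ̂ b<k)))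
                    (sign-opposite g≢g′ (trans (sym (x-z≡ g a)) (trans eq (x-z≡ g′ b)))))

  x≢x-z : ∀ {g g′ a b} → a ℕ.< k → b ℕ.< k → x g a ≢ x g′ b - z g′ b
  x≢x-z {g} {g′} {a} {b} a<k b<k eq with g Bool.≟ g′
  ... | yes refl = X≢X+ζ b<k (ι-injective (trans (sign-cancel g (trans eq (x-z≡ g b))) (sym (ι-+ (X b) (ζ b)))))
  ... | no g≢g′  = pos⇒≢0 (+-pos (0<X̂ a<k) (+-pos (0<X̂ b<k) (0<ζ̂ b<k))) (sign-opposite g≢g′ (trans eq (x-z≡ g′ b)))

  outerAt : Bool → ℕ → ℚ → ℚ
  outerAt g a y = (1ℚ - y) * z g a + y * x g a

  outerAt-difference : ∀ g a g′ b y →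
    outerAt g a y - outerAt g′ b y ≡ (1ℚ - y) * (z g a - z g′ b) + y * (x g a - x g′ b)
  outerAt-difference g a g′ b y = regroup y (z g a) (x g a) (z g′ b) (x g′ b)
    where
    regroup : ∀ y za xa zb xb → ((1ℚ - y) * za + y * xa) - ((1ℚ - y) * zb + y * xb) ≡ (1ℚ - y) * (za - zb) + y * (xa - xb)
    regroup = solve-∀ ringℚ

  same-side-difference : ∀ g {a b} y → a ℕ.< k → b ℕ.< k →
    outerAt g a y - outerAt g b y ≡ sign g * ((ι a - ι b) * ((1ℚ - y) * (ι a + ι b) + y * ι V))
  same-side-difference g {a} {b} y a<k b<k = begin
    outerAt g a y - outerAt g b y
      ≡⟨ outerAt-difference g a g b y ⟩
    (1ℚ - y) * (- s * ζ̂ a - - s * ζ̂ b) + y * (s * X̂ a - s * X̂ b)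
      ≡⟨ cong₂ (λ Δz Δx → (1ℚ - y) * Δz + y * Δx)
               (cong₂ (λ ζa ζb → - s * ζa - - s * ζb) (ζ̂-expand a<k) (ζ̂-expand b<k))
               (cong₂ (λ Xa Xb → s * Xa - s * Xb) (X̂-expand a) (X̂-expand b)) ⟩
    (1ℚ - y) * (- s * (ι Z - ι a * ι a) - - s * (ι Z - ι b * ι b)) + y * (s * (ι W + ι V * ι a) - s * (ι W + ι V * ι b))
      ≡⟨ factor s y (ι V) (ι W) (ι Z) (ι a) (ι b) ⟩
    s * ((ι a - ι b) * ((1ℚ - y) * (ι a + ι b) + y * ι V)) ∎
    where
    open ≡-Reasoning
    s = sign g
    factor : ∀ s y V W Z a b →
      (1ℚ - y) * (- s * (Z - a * a) - - s * (Z - b * b)) + y * (s * (W + V * a) - s * (W + V * b)) ≡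
      s * ((a - b) * ((1ℚ - y) * (a + b) + y * V))
    factor = solve-∀ ringℚ

  opposite-sides-difference : ∀ {g g′} a b y → g ≢ g′ →
    outerAt g a y - outerAt g′ b y ≡ sign g * ((1ℚ - y) * - (ζ̂ a + ζ̂ b) + y * (X̂ a + X̂ b))
  opposite-sides-difference {g} {g′} a b y g≢g′ = begin
    outerAt g a y - outerAt g′ b y
      ≡⟨ outerAt-difference g a g′ b y ⟩
    (1ℚ - y) * (- s * ζ̂ a - - sign g′ * ζ̂ b) + y * (s * X̂ a - sign g′ * X̂ b)
      ≡⟨ cong (λ s′ → (1ℚ - y) * (- s * ζ̂ a - - s′ * ζ̂ b) + y * (s * X̂ a - s′ * X̂ b)) (sign-flip g≢g′) ⟩
    (1ℚ - y) * (- s * ζ̂ a - - - s * ζ̂ b) + y * (s * X̂ a - - s * X̂ b)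
      ≡⟨ factor s y (X̂ a) (X̂ b) (ζ̂ a) (ζ̂ b) ⟩
    s * ((1ℚ - y) * - (ζ̂ a + ζ̂ b) + y * (X̂ a + X̂ b)) ∎
    where
    open ≡-Reasoning
    s = sign g
    factor : ∀ s y Xa Xb ζa ζb →
      (1ℚ - y) * (- s * ζa - - - s * ζb) + y * (s * Xa - - s * Xb) ≡ s * ((1ℚ - y) * - (ζa + ζb) + y * (Xa + Xb))
    factor = solve-∀ ringℚ

  0<ιa+ιb : ∀ {a b} → a ≢ b → 0ℚ < ι a + ι b
  0<ιa+ιb {zero}  {zero}  0≢0 = ⊥-elim (0≢0 refl)
  0<ιa+ιb {zero}  {suc b} _   = subst (0ℚ <_) (ι-+ 0 (suc b)) (0<ι {suc b} (ℕ.s≤s ℕ.z≤n))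
  0<ιa+ιb {suc a} {b}     _   = subst (0ℚ <_) (ι-+ (suc a) b) (0<ι {suc a ℕ.+ b} (ℕ.s≤s ℕ.z≤n))

  same-side-meeting : ∀ g {a b} y → a ≢ b → a ℕ.< k → b ℕ.< k → outerAt g a y ≡ outerAt g b y →
    (1ℚ - y) * (ι a + ι b) + y * ι V ≡ 0ℚ
  same-side-meeting g {a} {b} y a≢b a<k b<k eq =
    p*q≡0⇒q≡0 ιa-ιb≢0 (p*q≡0⇒q≡0 (sign≢0 g) (trans (sym (same-side-difference g y a<k b<k)) (p≡q⇒p-q≡0 eq)))
    where
    ιa-ιb≢0 : ι a - ι b ≢ 0ℚ
    ιa-ιb≢0 ιa-ιb≡0 = a≢b (ι-injective (p-q≡0⇒p≡q ιa-ιb≡0))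

  opposite-sides-meeting : ∀ {g g′ a b} y → g ≢ g′ → outerAt g a y ≡ outerAt g′ b y →
    (1ℚ - y) * - (ζ̂ a + ζ̂ b) + y * (X̂ a + X̂ b) ≡ 0ℚ
  opposite-sides-meeting {g} {g′} {a} {b} y g≢g′ eq =
    p*q≡0⇒q≡0 (sign≢0 g) (trans (sym (opposite-sides-difference a b y g≢g′)) (p≡q⇒p-q≡0 eq))

  same-side-meet-below : ∀ g {a b y} → a ≢ b → a ℕ.< k → b ℕ.< k → y < 1ℚ → outerAt g a y ≡ outerAt g b y → y < 0ℚ
  same-side-meet-below g {a} {b} {y} a≢b a<k b<k y<1 eq =
    convex-zero⇒t<0 (*-pos (0<ιa+ιb a≢b) (0<ι {V} (ℕ.s≤s ℕ.z≤n))) y<1 (same-side-meeting g y a≢b a<k b<k eq)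

  opposite-sides-meet-above : ∀ {g g′ a b y} → g ≢ g′ → a ℕ.< k → b ℕ.< k → y < 1ℚ →
    outerAt g a y ≡ outerAt g′ b y → 0ℚ < y
  opposite-sides-meet-above {g} {g′} {a} {b} {y} g≢g′ a<k b<k y<1 eq =
    convex-zero⇒0<t negative y<1 (opposite-sides-meeting y g≢g′ eq)
    where
    negative : - (ζ̂ a + ζ̂ b) * (X̂ a + X̂ b) < 0ℚ
    negative = subst (_< 0ℚ) (ℚ.neg-distribˡ-* (ζ̂ a + ζ̂ b) (X̂ a + X̂ b))
      (ℚ.neg-antimono-< (*-pos (+-pos (0<ζ̂ a<k) (0<ζ̂ b<k)) (+-pos (0<X̂ a<k) (0<X̂ b<k))))

  same-side-outer-edges-meet : ∀ g {a b} → a ≢ b → a ℕ.< k → b ℕ.< k →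
    ∃[ y ] (- 1ℚ < y × y < 1ℚ × outerAt g a y ≡ outerAt g b y)
  same-side-outer-edges-meet g {a} {b} a≢b a<k b<k = at (proper-fraction (0<ιa+ιb a≢b) ιa+ιb<ιV-ιa-ιb)
    where
    open ≡-Reasoning
    ιa+ιb<ιV-ιa-ιb : ι a + ι b < ι V - ι a - ι b
    ιa+ιb<ιV-ιa-ιb = 0<q-p⇒p<q (subst (0ℚ <_) (begin
      ι V - ι (2 ℕ.* (a ℕ.+ b))        ≡⟨ cong (λ r → ι V - r) (trans (ι-* 2 (a ℕ.+ b)) (cong (ι 2 *_) (ι-+ a b))) ⟩
      ι V - ι 2 * (ι a + ι b)          ≡⟨ regroup (ι V) (ι a) (ι b) ⟩
      (ι V - ι a - ι b) - (ι a + ι b)  ∎) (m<n⇒0<ιn-ιm (2[a+b]<V a<k b<k)))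
      where
      regroup : ∀ v a b → v - (1ℚ + (1ℚ + 0ℚ)) * (a + b) ≡ (v - a - b) - (a + b)
      regroup = solve-∀ ringℚ
    at : ∃[ μ ] (0ℚ < μ × μ < 1ℚ × μ * (ι V - ι a - ι b) ≡ ι a + ι b) →
      ∃[ y ] (- 1ℚ < y × y < 1ℚ × outerAt g a y ≡ outerAt g b y)
    at (μ , 0<μ , μ<1 , μ[V-a-b]≡a+b) =
      - μ , ℚ.neg-antimono-< μ<1 , ℚ.<-trans (ℚ.neg-antimono-< 0<μ) (ℚ.positive⁻¹ 1ℚ) , p-q≡0⇒p≡q (begin
        outerAt g a (- μ) - outerAt g b (- μ)                            ≡⟨ same-side-difference g (- μ) a<k b<k ⟩
        sign g * ((ι a - ι b) * ((1ℚ - - μ) * (ι a + ι b) + - μ * ι V))  ≡⟨ regroup (sign g) (ι a - ι b) μ (ι V) (ι a) (ι b) ⟩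
        sign g * ((ι a - ι b) * ((ι a + ι b) - μ * (ι V - ι a - ι b)))
          ≡⟨ cong (λ r → sign g * ((ι a - ι b) * ((ι a + ι b) - r))) μ[V-a-b]≡a+b ⟩
        sign g * ((ι a - ι b) * ((ι a + ι b) - (ι a + ι b)))             ≡⟨ vanish (sign g) (ι a - ι b) (ι a + ι b) ⟩
        0ℚ                                                               ∎)
      where
      regroup : ∀ s d μ v a b → s * (d * ((1ℚ - - μ) * (a + b) + - μ * v)) ≡ s * (d * ((a + b) - μ * (v - a - b)))
      regroup = solve-∀ ringℚ
      vanish : ∀ s d e → s * (d * (e - e)) ≡ 0ℚ
      vanish = solve-∀ ringℚ

  opposite-sides-outer-edges-meet : ∀ {g g′ a b} → g ≢ g′ → a ℕ.< k → b ℕ.< k →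
    ∃[ y ] (- 1ℚ < y × y < 1ℚ × outerAt g a y ≡ outerAt g′ b y)
  opposite-sides-outer-edges-meet {g} {g′} {a} {b} g≢g′ a<k b<k = at (proper-fraction (+-pos (0<ζ̂ a<k) (0<ζ̂ b<k)) N<S+N)
    where
    open ≡-Reasoning
    N<S+N : ζ̂ a + ζ̂ b < (X̂ a + X̂ b) + (ζ̂ a + ζ̂ b)
    N<S+N = subst (_< (X̂ a + X̂ b) + (ζ̂ a + ζ̂ b)) (ℚ.+-identityˡ (ζ̂ a + ζ̂ b))
      (ℚ.+-monoˡ-< (ζ̂ a + ζ̂ b) (+-pos (0<X̂ a<k) (0<X̂ b<k)))
    at : ∃[ μ ] (0ℚ < μ × μ < 1ℚ × μ * ((X̂ a + X̂ b) + (ζ̂ a + ζ̂ b)) ≡ ζ̂ a + ζ̂ b) →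
      ∃[ y ] (- 1ℚ < y × y < 1ℚ × outerAt g a y ≡ outerAt g′ b y)
    at (μ , 0<μ , μ<1 , μ[S+N]≡N) =
      μ , ℚ.<-trans (ℚ.neg-antimono-< (ℚ.positive⁻¹ 1ℚ)) 0<μ , μ<1 , p-q≡0⇒p≡q (begin
        outerAt g a μ - outerAt g′ b μ                              ≡⟨ opposite-sides-difference a b μ g≢g′ ⟩
        sign g * ((1ℚ - μ) * - (ζ̂ a + ζ̂ b) + μ * (X̂ a + X̂ b))       ≡⟨ regroup (sign g) μ (X̂ a + X̂ b) (ζ̂ a + ζ̂ b) ⟩
        sign g * (μ * ((X̂ a + X̂ b) + (ζ̂ a + ζ̂ b)) - (ζ̂ a + ζ̂ b))   ≡⟨ cong (sign g *_) (p≡q⇒p-q≡0 μ[S+N]≡N) ⟩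
        sign g * 0ℚ                                                 ≡⟨ ℚ.*-zeroʳ (sign g) ⟩
        0ℚ                                                          ∎)
      where
      regroup : ∀ s μ S N → s * ((1ℚ - μ) * - N + μ * S) ≡ s * (μ * (S + N) - N)
      regroup = solve-∀ ringℚ

  outer-edges-meet : ∀ {g g′ a b} → ¬ (g ≡ g′ × a ≡ b) → a ℕ.< k → b ℕ.< k →
    ∃[ y ] (- 1ℚ < y × y < 1ℚ × outerAt g a y ≡ outerAt g′ b y)
  outer-edges-meet {g} {g′} legs≢ a<k b<k with g Bool.≟ g′
  ... | yes refl = same-side-outer-edges-meet g (λ a≡b → legs≢ (refl , a≡b)) a<k b<k
  ... | no g≢g′  = opposite-sides-outer-edges-meet g≢g′ a<k b<k

  same-side-concurrent : ∀ g {a b c y} → a ≢ b → a ≢ c → a ℕ.< k → b ℕ.< k → c ℕ.< k → y < 1ℚ →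
    outerAt g a y ≡ outerAt g b y → outerAt g a y ≡ outerAt g c y → b ≡ c
  same-side-concurrent g {a} {b} {c} {y} a≢b a≢c a<k b<k c<k y<1 ab ac =
    ι-injective (p-q≡0⇒p≡q (p*q≡0⇒q≡0 (pos⇒≢0 (p<q⇒0<q-p y<1)) (begin
      (1ℚ - y) * (ι b - ι c)                                                  ≡⟨ regroup y (ι a) (ι b) (ι c) (ι V) ⟩
      ((1ℚ - y) * (ι a + ι b) + y * ι V) - ((1ℚ - y) * (ι a + ι c) + y * ι V)
        ≡⟨ cong₂ _-_ (same-side-meeting g y a≢b a<k b<k ab) (same-side-meeting g y a≢c a<k c<k ac) ⟩
      0ℚ - 0ℚ                                                                 ≡⟨ ℚ.+-inverseʳ 0ℚ ⟩
      0ℚ                                                                      ∎)))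
    where
    open ≡-Reasoning
    regroup : ∀ y a b c v → (1ℚ - y) * (b - c) ≡ ((1ℚ - y) * (a + b) + y * v) - ((1ℚ - y) * (a + c) + y * v)
    regroup = solve-∀ ringℚ

  -- If the inner edge of j meets the outer edges of a and b at the same
  -- height y ≠ 0, this determinant of their coordinates vanishes.
  concurrent⇒determinant≡0 : ∀ {y xj za xa zb xb} → y ≢ 0ℚ →
    y * xj ≡ (1ℚ - y) * za + y * xa → y * xj ≡ (1ℚ - y) * zb + y * xb → (xj - xa) * zb - (xj - xb) * za ≡ 0ℚ
  concurrent⇒determinant≡0 {y} {xj} {za} {xa} {zb} {xb} y≢0 ja jb = p*q≡0⇒q≡0 y≢0 (begin
    y * ((xj - xa) * zb - (xj - xb) * za)
      ≡⟨ expand y xj za xa zb xb ⟩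
    zb * (y * xj - ((1ℚ - y) * za + y * xa)) - za * (y * xj - ((1ℚ - y) * zb + y * xb))
      ≡⟨ cong₂ (λ p q → zb * p - za * q) (p≡q⇒p-q≡0 ja) (p≡q⇒p-q≡0 jb) ⟩
    zb * 0ℚ - za * 0ℚ
      ≡⟨ vanish za zb ⟩
    0ℚ ∎)
    where
    open ≡-Reasoning
    expand : ∀ y xj za xa zb xb → y * ((xj - xa) * zb - (xj - xb) * za) ≡
      zb * (y * xj - ((1ℚ - y) * za + y * xa)) - za * (y * xj - ((1ℚ - y) * zb + y * xb))
    expand = solve-∀ ringℚ
    vanish : ∀ za zb → zb * 0ℚ - za * 0ℚ ≡ 0ℚ
    vanish = solve-∀ ringℚ

  0<gap : ∀ j {a b} → a ℕ.< k → b ℕ.< k → 0ℚ < (X̂ j * ζ̂ b + X̂ j * ζ̂ a + X̂ b * ζ̂ a) - X̂ a * ζ̂ b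
  0<gap j {a} {b} a<k b<k = subst (0ℚ <_) (cong₂ _-_ expand (ι-* (X a) (ζ b))) (m<n⇒0<ιn-ιm (X*ζ-gap j a<k b<k))
    where
    expand : ι (X j ℕ.* ζ b ℕ.+ X j ℕ.* ζ a ℕ.+ X b ℕ.* ζ a) ≡ X̂ j * ζ̂ b + X̂ j * ζ̂ a + X̂ b * ζ̂ a
    expand = trans (ι-+ (X j ℕ.* ζ b ℕ.+ X j ℕ.* ζ a) (X b ℕ.* ζ a))
      (cong₂ _+_ (trans (ι-+ (X j ℕ.* ζ b) (X j ℕ.* ζ a)) (cong₂ _+_ (ι-* (X j) (ζ b)) (ι-* (X j) (ζ a)))) (ι-* (X b) (ζ a)))

  determinant≢0 : ∀ g {j a b} → a ℕ.< k → b ℕ.< k →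
    (x g j - x true a) * z false b - (x g j - x false b) * z true a ≢ 0ℚ
  determinant≢0 true {j} {a} {b} a<k b<k det≡0 =
    pos⇒≢0 (0<gap j a<k b<k) (trans (expand (X̂ j) (X̂ a) (X̂ b) (ζ̂ a) (ζ̂ b)) det≡0)
    where
    expand : ∀ Xj Xa Xb ζa ζb → (Xj * ζb + Xj * ζa + Xb * ζa) - Xa * ζb ≡
      (1ℚ * Xj - 1ℚ * Xa) * (- - 1ℚ * ζb) - (1ℚ * Xj - - 1ℚ * Xb) * (- 1ℚ * ζa)
    expand = solve-∀ ringℚ
  determinant≢0 false {j} {a} {b} a<k b<k det≡0 =
    pos⇒≢0 (0<gap j b<k a<k) (trans (expand (X̂ j) (X̂ a) (X̂ b) (ζ̂ a) (ζ̂ b)) (trans (cong -_ det≡0) refl))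
    where
    expand : ∀ Xj Xa Xb ζa ζb → (Xj * ζa + Xj * ζb + Xa * ζb) - Xb * ζa ≡
      - ((- 1ℚ * Xj - 1ℚ * Xa) * (- - 1ℚ * ζb) - (- 1ℚ * Xj - - 1ℚ * Xb) * (- 1ℚ * ζa))
    expand = solve-∀ ringℚ

  no-inner-meets-two-outers : ∀ gj ga gb {j a b y} → a ℕ.< k → b ℕ.< k → ¬ (ga ≡ gb × a ≡ b) →
    0ℚ < y → y < 1ℚ → y * x gj j ≡ outerAt ga a y → y * x gj j ≡ outerAt gb b y → ⊥
  no-inner-meets-two-outers gj ga gb {y = y} a<k b<k legs≢ 0<y y<1 ja jb with ga Bool.≟ gb
  ... | yes refl = ℚ.<-asym 0<y (same-side-meet-below ga (λ a≡b → legs≢ (refl , a≡b)) a<k b<k y<1 (trans (sym ja) jb))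
  no-inner-meets-two-outers gj true  false a<k b<k _ 0<y _ ja jb | no _ =
    determinant≢0 gj a<k b<k (concurrent⇒determinant≡0 (pos⇒≢0 0<y) ja jb)
  no-inner-meets-two-outers gj false true  a<k b<k _ 0<y _ ja jb | no _ =
    determinant≢0 gj b<k a<k (concurrent⇒determinant≡0 (pos⇒≢0 0<y) jb ja)
  no-inner-meets-two-outers gj true  true  _ _ _ _ _ _ _ | no g≢g = g≢g refl
  no-inner-meets-two-outers gj false false _ _ _ _ _ _ _ | no g≢g = g≢g refl

  -- Two of any three legs lie on the same side; those meet below the
  -- axis, whereas legs on opposite sides meet above it.
  no-three-outers-meet : ∀ ga gb gc {a b c y} → a ℕ.< k → b ℕ.< k → c ℕ.< k →
    ¬ (ga ≡ gb × a ≡ b) → ¬ (ga ≡ gc × a ≡ c) → ¬ (gb ≡ gc × b ≡ c) → y < 1ℚ →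
    outerAt ga a y ≡ outerAt gb b y → outerAt ga a y ≡ outerAt gc c y → ⊥
  no-three-outers-meet ga gb gc a<k b<k c<k ab≢ ac≢ bc≢ y<1 ab ac with ga Bool.≟ gb | ga Bool.≟ gc
  ... | yes refl | yes refl =
    bc≢ (refl , same-side-concurrent ga (λ e → ab≢ (refl , e)) (λ e → ac≢ (refl , e)) a<k b<k c<k y<1 ab ac)
  ... | yes refl | no ga≢gc =
    ℚ.<-asym (same-side-meet-below ga (λ e → ab≢ (refl , e)) a<k b<k y<1 ab) (opposite-sides-meet-above ga≢gc a<k c<k y<1 ac)
  ... | no ga≢gb | yes refl =
    ℚ.<-asym (same-side-meet-below ga (λ e → ac≢ (refl , e)) a<k c<k y<1 ac) (opposite-sides-meet-above ga≢gb a<k b<k y<1 ab)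
  ... | no ga≢gb | no ga≢gc with trans (Bool.¬-not (ga≢gb ∘ sym)) (sym (Bool.¬-not (ga≢gc ∘ sym)))
  ...   | refl =
    ℚ.<-asym (same-side-meet-below gb (λ e → bc≢ (refl , e)) b<k c<k y<1 (trans (sym ab) ac))
             (opposite-sides-meet-above ga≢gb a<k b<k y<1 ab)

  z-first<0 : ∀ {a} → a ℕ.< k → z true a < 0ℚ
  z-first<0 {a} a<k = subst (_< 0ℚ) (ℚ.neg-distribˡ-* 1ℚ (ζ̂ a)) (ℚ.neg-antimono-< (*-pos (ℚ.positive⁻¹ 1ℚ) (0<ζ̂ a<k)))

  0<z-second : ∀ {a} → a ℕ.< k → 0ℚ < z false a
  0<z-second {a} a<k = subst (0ℚ <_) (sym (ℚ.*-identityˡ (ζ̂ a))) (0<ζ̂ a<k)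

  0<x-first : ∀ {a} → a ℕ.< k → 0ℚ < x true a
  0<x-first {a} a<k = subst (0ℚ <_) (sym (ℚ.*-identityˡ (X̂ a))) (0<X̂ a<k)

  x-second<0 : ∀ {a} → a ℕ.< k → x false a < 0ℚ
  x-second<0 {a} a<k = subst (_< 0ℚ) (ℚ.neg-distribˡ-* 1ℚ (X̂ a)) (ℚ.neg-antimono-< (*-pos (ℚ.positive⁻¹ 1ℚ) (0<X̂ a<k)))

  x-first-mono : ∀ {a b} → a ℕ.< b → x true a < x true b
  x-first-mono {a} {b} a<b = subst₂ _<_ (sym (ℚ.*-identityˡ (X̂ a))) (sym (ℚ.*-identityˡ (X̂ b))) (ι-mono-< (X-mono a<b))

  x-second-anti : ∀ {a b} → a ℕ.< b → x false b < x false a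
  x-second-anti {a} {b} a<b = subst₂ _<_ (ℚ.neg-distribˡ-* 1ℚ (X̂ b)) (ℚ.neg-distribˡ-* 1ℚ (X̂ a))
    (ℚ.neg-antimono-< (subst₂ _<_ (sym (ℚ.*-identityˡ (X̂ a))) (sym (ℚ.*-identityˡ (X̂ b))) (ι-mono-< (X-mono a<b))))

-- The outer edge of leg i is { (outerAt i y , y) : -1 ≤ y ≤ 1 }, crossing
-- the horizontal axis at z i, and its inner edge is { (y x i , y) : 0 ≤ y ≤ 1 };
-- every edge is a graph over the height y, so edges are compared height by height.
module SpiderOnStrip {k : ℕ} (x z : Fin k → ℚ) where

  open import Data.Rational.Base using (_+_; _*_; _-_; -_; _≤_; _<_)

  open ℚ-Lemmas
  open Segments

  position : Vertex k → Point
  position center   = 0ℚ , 0ℚ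
  position (mid i)  = x i , 1ℚ
  position (leaf i) = (z i + z i) - x i , - 1ℚ

  outerAt : Fin k → ℚ → ℚ
  outerAt i y = (1ℚ - y) * z i + y * x i

  InnerAt OuterAt : Fin k → Point → Set
  InnerAt i = InSegInterior (position center) (position (mid i))
  OuterAt i = InSegInterior (position (mid i)) (position (leaf i))

  inner-point : ∀ i {y} → 0ℚ < y → y < 1ℚ → InnerAt i (y * x i , y)
  inner-point i {y} 0<y y<1 = y , 0<y , y<1 , sym (cong₂ _,_ (first (x i) y) (second y))
    where
    first : ∀ x y → 0ℚ + y * (x - 0ℚ) ≡ y * x
    first = solve-∀ ringℚ
    second : ∀ y → 0ℚ + y * (1ℚ - 0ℚ) ≡ y
    second = solve-∀ ringℚ

  outer-point : ∀ i {y} → - 1ℚ < y → y < 1ℚ → OuterAt i (outerAt i y , y)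
  outer-point i {y} -1<y y<1 = s , 0<s , s<1 , sym (cong₂ _,_ (first (x i) (z i) y) (second y))
    where
    s = (1ℚ - y) * ½
    0<s : 0ℚ < s
    0<s = *-pos (p<q⇒0<q-p y<1) (ℚ.positive⁻¹ ½)
    s<1 : s < 1ℚ
    s<1 = 0<q-p⇒p<q (subst (0ℚ <_) (sym (complement y)) (*-pos (p<q⇒0<q-p -1<y) (ℚ.positive⁻¹ ½)))
      where
      complement : ∀ y → 1ℚ - (1ℚ - y) * ½ ≡ (y - - 1ℚ) * ½
      complement = solve-∀ ringℚ
    first : ∀ x z y → x + ((1ℚ - y) * ½) * (((z + z) - x) - x) ≡ (1ℚ - y) * z + y * x
    first = solve-∀ ringℚ
    second : ∀ y → 1ℚ + ((1ℚ - y) * ½) * (- 1ℚ - 1ℚ) ≡ y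
    second = solve-∀ ringℚ

  inner-point⁻¹ : ∀ i {P} → InnerAt i P → proj₁ P ≡ proj₂ P * x i × 0ℚ < proj₂ P × proj₂ P < 1ℚ
  inner-point⁻¹ i {px , py} (t , 0<t , t<1 , P≡) =
    trans (cong proj₁ P≡) (trans (first (x i) t) (cong (_* x i) (sym py≡t))) ,
    subst (0ℚ <_) (sym py≡t) 0<t , subst (_< 1ℚ) (sym py≡t) t<1
    where
    first : ∀ x t → 0ℚ + t * (x - 0ℚ) ≡ t * x
    first = solve-∀ ringℚ
    second : ∀ t → 0ℚ + t * (1ℚ - 0ℚ) ≡ t
    second = solve-∀ ringℚ
    py≡t : py ≡ t
    py≡t = trans (cong proj₂ P≡) (second t)

  outer-point⁻¹ : ∀ i {P} → OuterAt i P → proj₁ P ≡ outerAt i (proj₂ P) × - 1ℚ < proj₂ P × proj₂ P < 1ℚ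
  outer-point⁻¹ i {px , py} (s , 0<s , s<1 , P≡) = px≡ , -1<py , py<1
    where
    py≡ : py ≡ 1ℚ + s * (- 1ℚ - 1ℚ)
    py≡ = cong proj₂ P≡
    first : ∀ x z s → x + s * (((z + z) - x) - x) ≡ (1ℚ - (1ℚ + s * (- 1ℚ - 1ℚ))) * z + (1ℚ + s * (- 1ℚ - 1ℚ)) * x
    first = solve-∀ ringℚ
    px≡ : px ≡ outerAt i py
    px≡ = trans (cong proj₁ P≡) (trans (first (x i) (z i) s) (cong (λ y → (1ℚ - y) * z i + y * x i) (sym py≡)))
    two = 1ℚ + 1ℚ
    above : ∀ s → (1ℚ + s * (- 1ℚ - 1ℚ)) - - 1ℚ ≡ (1ℚ - s) * two
    above = solve-∀ ringℚ
    below : ∀ s → 1ℚ - (1ℚ + s * (- 1ℚ - 1ℚ)) ≡ s * two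
    below = solve-∀ ringℚ
    -1<py : - 1ℚ < py
    -1<py = 0<q-p⇒p<q (subst (0ℚ <_) (sym (trans (cong (_- - 1ℚ) py≡) (above s))) (*-pos (p<q⇒0<q-p s<1) (ℚ.positive⁻¹ two)))
    py<1 : py < 1ℚ
    py<1 = 0<q-p⇒p<q (subst (0ℚ <_) (sym (trans (cong (λ y → 1ℚ - y) py≡) (below s))) (*-pos 0<s (ℚ.positive⁻¹ two)))

  -- Between heights 0 and 1 the inner edge of j and the outer edge of i
  -- swap their left-to-right order.
  SwapOrder : Fin k → Fin k → Set
  SwapOrder j i = (z i < 0ℚ × x j < x i) ⊎ (0ℚ < z i × x i < x j)

  inner-meets-outer : ∀ j i → SwapOrder j i →
    ∃[ y ] (0ℚ < y × y < 1ℚ × y * x j ≡ outerAt i y)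
  inner-meets-outer j i (inj₁ (z<0 , xj<xi)) = at (proper-fraction 0<-z -z<D)
    where
    -z<D : - z i < (x i - x j) + - z i
    -z<D = subst (_< (x i - x j) + - z i) (ℚ.+-identityˡ (- z i)) (ℚ.+-monoˡ-< (- z i) (p<q⇒0<q-p xj<xi))
    0<-z = p<0⇒0<-p z<0
    at : ∃[ y ] (0ℚ < y × y < 1ℚ × y * ((x i - x j) + - z i) ≡ - z i) → ∃[ y ] (0ℚ < y × y < 1ℚ × y * x j ≡ outerAt i y)
    at (y , 0<y , y<1 , yD≡-z) = y , 0<y , y<1 , p-q≡0⇒p≡q (begin
      y * x j - outerAt i y                ≡⟨ regroup y (x i) (x j) (z i) ⟩
      - (y * ((x i - x j) + - z i)) - z i  ≡⟨ cong (λ r → - r - z i) yD≡-z ⟩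
      - - z i - z i                        ≡⟨ cancel (z i) ⟩
      0ℚ                                   ∎)
      where
      open ≡-Reasoning
      regroup : ∀ y xi xj z → y * xj - ((1ℚ - y) * z + y * xi) ≡ - (y * ((xi - xj) + - z)) - z
      regroup = solve-∀ ringℚ
      cancel : ∀ z → - - z - z ≡ 0ℚ
      cancel = solve-∀ ringℚ
  inner-meets-outer j i (inj₂ (0<z , xi<xj)) = at (proper-fraction 0<z z<D)
    where
    z<D : z i < (x j - x i) + z i
    z<D = subst (_< (x j - x i) + z i) (ℚ.+-identityˡ (z i)) (ℚ.+-monoˡ-< (z i) (p<q⇒0<q-p xi<xj))
    at : ∃[ y ] (0ℚ < y × y < 1ℚ × y * ((x j - x i) + z i) ≡ z i) → ∃[ y ] (0ℚ < y × y < 1ℚ × y * x j ≡ outerAt i y)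
    at (y , 0<y , y<1 , yD≡z) = y , 0<y , y<1 , p-q≡0⇒p≡q (begin
      y * x j - outerAt i y           ≡⟨ regroup y (x i) (x j) (z i) ⟩
      y * ((x j - x i) + z i) - z i   ≡⟨ p≡q⇒p-q≡0 yD≡z ⟩
      0ℚ                              ∎)
      where
      open ≡-Reasoning
      regroup : ∀ y xi xj z → y * xj - ((1ℚ - y) * z + y * xi) ≡ y * ((xj - xi) + z) - z
      regroup = solve-∀ ringℚ

  module GoodDrawing
    (x-injective : ∀ {i j} → x i ≡ x j → i ≡ j)
    (x≢x-z : ∀ i j → x i ≢ x j - z j)
    (x-z-injective : ∀ {i j} → x i - z i ≡ x j - z j → i ≡ j)
    (z≢0 : ∀ i → z i ≢ 0ℚ)
    (outers-meet : ∀ {i j} → i ≢ j → ∃[ y ] (- 1ℚ < y × y < 1ℚ × outerAt i y ≡ outerAt j y))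
    (no-inner-meets-two-outers : ∀ j {a b y} → a ≢ b → 0ℚ < y → y < 1ℚ →
      y * x j ≡ outerAt a y → y * x j ≡ outerAt b y → ⊥)
    (no-three-outers-meet : ∀ {a b c y} → a ≢ b → a ≢ c → b ≢ c → y < 1ℚ →
      outerAt a y ≡ outerAt b y → outerAt a y ≡ outerAt c y → ⊥)
    where

    private
      2≢0 : 1ℚ + 1ℚ ≢ 0ℚ
      2≢0 ()
      4≢0 : (1ℚ + 1ℚ) * (1ℚ + 1ℚ) ≢ 0ℚ
      4≢0 ()

    nonParallel : ∀ e f → e ≢ f → cross (position (src e)) (position (tgt e)) (position (src f)) (position (tgt f)) ≢ 0ℚ
    nonParallel (inner i) (inner j) i≢j cross≡0 =
      i≢j (cong inner (x-injective (p-q≡0⇒p≡q (trans (sym (expand (x i) (x j))) cross≡0))))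
      where
      expand : ∀ a b → (a - 0ℚ) * (1ℚ - 0ℚ) - (1ℚ - 0ℚ) * (b - 0ℚ) ≡ a - b
      expand = solve-∀ ringℚ
    nonParallel (inner i) (outer j) _ cross≡0 =
      x≢x-z i j (sym (p-q≡0⇒p≡q (p*q≡0⇒q≡0 2≢0 (trans (sym (expand (x i) (x j) (z j))) cross≡0))))
      where
      expand : ∀ xi xj zj → (xi - 0ℚ) * (- 1ℚ - 1ℚ) - (1ℚ - 0ℚ) * (((zj + zj) - xj) - xj) ≡ (1ℚ + 1ℚ) * ((xj - zj) - xi)
      expand = solve-∀ ringℚ
    nonParallel (outer i) (inner j) _ cross≡0 =
      x≢x-z j i (p-q≡0⇒p≡q (p*q≡0⇒q≡0 2≢0 (trans (sym (expand (x i) (z i) (x j))) cross≡0)))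
      where
      expand : ∀ xi zi xj → (((zi + zi) - xi) - xi) * (1ℚ - 0ℚ) - (- 1ℚ - 1ℚ) * (xj - 0ℚ) ≡ (1ℚ + 1ℚ) * (xj - (xi - zi))
      expand = solve-∀ ringℚ
    nonParallel (outer i) (outer j) i≢j cross≡0 =
      i≢j (cong outer (x-z-injective (p-q≡0⇒p≡q (p*q≡0⇒q≡0 4≢0 (trans (sym (expand (x i) (z i) (x j) (z j))) cross≡0)))))
      where
      expand : ∀ xi zi xj zj → (((zi + zi) - xi) - xi) * (- 1ℚ - 1ℚ) - (- 1ℚ - 1ℚ) * (((zj + zj) - xj) - xj) ≡
        ((1ℚ + 1ℚ) * (1ℚ + 1ℚ)) * ((xi - zi) - (xj - zj))
      expand = solve-∀ ringℚ

    meet-at-most-once : ∀ e f → e ≢ f → ∀ P Q →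
      OnSeg (position (src e)) (position (tgt e)) P → OnSeg (position (src f)) (position (tgt f)) P →
      OnSeg (position (src e)) (position (tgt e)) Q → OnSeg (position (src f)) (position (tgt f)) Q → P ≡ Q
    meet-at-most-once e f e≢f =
      nonParallel⇒meet-at-most-once (position (src e)) (position (tgt e)) (position (src f)) (position (tgt f)) (nonParallel e f e≢f)

    -- Two distinct outer edges cross strictly above the leaves, so the
    -- leaves cannot coincide.
    position-injective : ∀ u v → position u ≡ position v → u ≡ v
    position-injective center   center   _  = refl
    position-injective (mid i)  (mid j)  eq = cong mid (x-injective (cong proj₁ eq))
    position-injective (leaf i) (leaf j) eq with i Fin.≟ j
    ... | yes i≡j = cong leaf i≡j
    ... | no i≢j with outers-meet i≢j
    ...   | y , -1<y , y<1 , meet = ⊥-elim (ℚ.<-irrefl (sym (cong proj₂ P≡leaf)) -1<y)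
      where
      on-j : OuterAt j (outerAt i y , y)
      on-j = subst (λ p → OuterAt j (p , y)) (sym meet) (outer-point j -1<y y<1)
      P≡leaf : (outerAt i y , y) ≡ position (leaf i)
      P≡leaf = meet-at-most-once (outer i) (outer j) (λ { refl → i≢j refl }) _ _
        (interior⇒onSeg (position (mid i)) (position (leaf i)) (outer-point i -1<y y<1))
        (interior⇒onSeg (position (mid j)) (position (leaf j)) on-j)
        (end-onSeg (position (mid i)) (position (leaf i)))
        (subst (OnSeg (position (mid j)) (position (leaf j))) (sym eq) (end-onSeg (position (mid j)) (position (leaf j))))
    position-injective center   (mid _)  eq with () ← cong proj₂ eq
    position-injective center   (leaf _) eq with () ← cong proj₂ eq
    position-injective (mid _)  center   eq with () ← cong proj₂ eq
    position-injective (mid _)  (leaf _) eq with () ← cong proj₂ eq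
    position-injective (leaf _) center   eq with () ← cong proj₂ eq
    position-injective (leaf _) (mid _)  eq with () ← cong proj₂ eq

    no-vertex-inside-edge : ∀ e v → ¬ InSegInterior (position (src e)) (position (tgt e)) (position v)
    no-vertex-inside-edge (inner i) center   inside = ℚ.<-irrefl refl (proj₁ (proj₂ (inner-point⁻¹ i inside)))
    no-vertex-inside-edge (inner i) (mid _)  inside = ℚ.<-irrefl refl (proj₂ (proj₂ (inner-point⁻¹ i inside)))
    no-vertex-inside-edge (inner i) (leaf _) inside =
      ℚ.<-asym (proj₁ (proj₂ (inner-point⁻¹ i inside))) (ℚ.neg-antimono-< (ℚ.positive⁻¹ 1ℚ))
    no-vertex-inside-edge (outer i) center   inside =
      z≢0 i (sym (trans (proj₁ (outer-point⁻¹ i inside)) (at-axis (z i) (x i))))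
      where
      at-axis : ∀ z x → (1ℚ - 0ℚ) * z + 0ℚ * x ≡ z
      at-axis = solve-∀ ringℚ
    no-vertex-inside-edge (outer i) (mid _)  inside = ℚ.<-irrefl refl (proj₂ (proj₂ (outer-point⁻¹ i inside)))
    no-vertex-inside-edge (outer i) (leaf _) inside = ℚ.<-irrefl refl (proj₁ (proj₂ (outer-point⁻¹ i inside)))

    inner-inner-concurrent : ∀ i j {P} → InnerAt i P → InnerAt j P → i ≡ j
    inner-inner-concurrent i j {P} i∋P j∋P = x-injective (*-cancelˡ-≡ (pos⇒≢0 0<py)
      (trans (sym (proj₁ (inner-point⁻¹ i i∋P))) (proj₁ (inner-point⁻¹ j j∋P))))
      where
      0<py = proj₁ (proj₂ (inner-point⁻¹ i i∋P))

    inner-outer-outer-concurrent : ∀ j a b {P} → a ≢ b → InnerAt j P → OuterAt a P → OuterAt b P → ⊥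
    inner-outer-outer-concurrent j a b a≢b j∋P a∋P b∋P =
      no-inner-meets-two-outers j a≢b (proj₁ (proj₂ on-j)) (proj₂ (proj₂ on-j))
        (trans (sym (proj₁ on-j)) (proj₁ (outer-point⁻¹ a a∋P))) (trans (sym (proj₁ on-j)) (proj₁ (outer-point⁻¹ b b∋P)))
      where
      on-j = inner-point⁻¹ j j∋P

    outer-outer-outer-concurrent : ∀ a b c {P} → a ≢ b → a ≢ c → b ≢ c → OuterAt a P → OuterAt b P → OuterAt c P → ⊥
    outer-outer-outer-concurrent a b c a≢b a≢c b≢c a∋P b∋P c∋P =
      no-three-outers-meet a≢b a≢c b≢c (proj₂ (proj₂ on-a))
        (trans (sym (proj₁ on-a)) (proj₁ (outer-point⁻¹ b b∋P))) (trans (sym (proj₁ on-a)) (proj₁ (outer-point⁻¹ c c∋P)))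
      where
      on-a = outer-point⁻¹ a a∋P

    no-triple-crossing-point : ∀ e f g → e ≢ f → e ≢ g → f ≢ g → ∀ P →
      InSegInterior (position (src e)) (position (tgt e)) P → InSegInterior (position (src f)) (position (tgt f)) P →
      ¬ InSegInterior (position (src g)) (position (tgt g)) P
    no-triple-crossing-point (inner i) (inner j) _ i≢j _ _ _ i∋P j∋P _ = i≢j (cong inner (inner-inner-concurrent i j i∋P j∋P))
    no-triple-crossing-point (inner i) (outer _) (inner j) _ i≢j _ _ i∋P _ j∋P = i≢j (cong inner (inner-inner-concurrent i j i∋P j∋P))
    no-triple-crossing-point (outer _) (inner i) (inner j) _ _ i≢j _ _ i∋P j∋P = i≢j (cong inner (inner-inner-concurrent i j i∋P j∋P))
    no-triple-crossing-point (inner j) (outer a) (outer b) _ _ a≢b _ j∋P a∋P b∋P =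
      inner-outer-outer-concurrent j a b (λ { refl → a≢b refl }) j∋P a∋P b∋P
    no-triple-crossing-point (outer a) (inner j) (outer b) _ a≢b _ _ a∋P j∋P b∋P =
      inner-outer-outer-concurrent j a b (λ { refl → a≢b refl }) j∋P a∋P b∋P
    no-triple-crossing-point (outer a) (outer b) (inner j) a≢b _ _ _ a∋P b∋P j∋P =
      inner-outer-outer-concurrent j a b (λ { refl → a≢b refl }) j∋P a∋P b∋P
    no-triple-crossing-point (outer a) (outer b) (outer c) a≢b a≢c b≢c _ a∋P b∋P c∋P =
      outer-outer-outer-concurrent a b c (λ { refl → a≢b refl }) (λ { refl → a≢c refl }) (λ { refl → b≢c refl }) a∋P b∋P c∋P

    drawing : RectDrawing k
    drawing = record
      { pos                = position
      ; pos-injective      = position-injective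
      ; no-vertex-inside   = no-vertex-inside-edge
      ; share-at-most-one  = meet-at-most-once
      ; no-triple-crossing = no-triple-crossing-point
      }

    outer-outer-crossing : ∀ {i j} → toℕ i ℕ.< toℕ j → Crossing drawing
    outer-outer-crossing {i} {j} i<j =
      outer i , outer j , ℕ.+-monoʳ-< k i<j , (outerAt i y , y) , outer-point i -1<y y<1 ,
      subst (λ p → OuterAt j (p , y)) (sym meet) (outer-point j -1<y y<1)
      where
      meeting = outers-meet (Fin.<⇒≢ i<j)
      y = proj₁ meeting
      -1<y = proj₁ (proj₂ meeting)
      y<1 = proj₁ (proj₂ (proj₂ meeting))
      meet = proj₂ (proj₂ (proj₂ meeting))

    inner-outer-crossing : ∀ {j i} → SwapOrder j i → Crossing drawing
    inner-outer-crossing {j} {i} swap =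
      inner j , outer i , ℕ.<-≤-trans (Fin.toℕ<n j) (ℕ.m≤m+n k (toℕ i)) , (y * x j , y) , inner-point j 0<y y<1 ,
      subst (λ p → OuterAt i (p , y)) (sym meet) (outer-point i (ℚ.<-trans (ℚ.neg-antimono-< (ℚ.positive⁻¹ 1ℚ)) 0<y) y<1)
      where
      meeting = inner-meets-outer j i swap
      y = proj₁ meeting
      0<y = proj₁ (proj₂ meeting)
      y<1 = proj₁ (proj₂ (proj₂ meeting))
      meet = proj₂ (proj₂ (proj₂ meeting))

-- The first p legs go to one side (x > 0, z < 0), the others to the other
-- side (x < 0, z > 0); legs are numbered outwards on each side.
module TwoSidedSpider (k′ p : ℕ) (p≤k : p ℕ.≤ suc k′) where

  open import Data.Rational.Base using (_+_; _*_; _-_; -_; _≤_; _<_)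

  private
    k = suc k′

  module C = Coordinates k

  side : Fin k → Bool
  side i = does (toℕ i ℕ.<? p)

  index-by : ∀ n → Dec (n ℕ.< p) → ℕ
  index-by n (yes _) = n
  index-by n (no _)  = n ∸ p

  index : Fin k → ℕ
  index i = index-by (toℕ i) (toℕ i ℕ.<? p)

  data Placement (i : Fin k) : Set where
    first  : toℕ i ℕ.< p → side i ≡ true  → index i ≡ toℕ i     → Placement i
    second : p ℕ.≤ toℕ i → side i ≡ false → index i ≡ toℕ i ∸ p → Placement i

  placement : ∀ i → Placement i
  placement i = by (toℕ i ℕ.<? p) refl refl
    where
    by : (d : Dec (toℕ i ℕ.< p)) → does d ≡ side i → index-by (toℕ i) d ≡ index i → Placement i
    by (yes i<p) side≡ index≡ = first i<p (sym side≡) (sym index≡)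
    by (no i≮p)  side≡ index≡ = second (ℕ.≮⇒≥ i≮p) (sym side≡) (sym index≡)

  index<k : ∀ i → index i ℕ.< k
  index<k i with placement i
  ... | first  _ _ eq = subst (ℕ._< k) (sym eq) (Fin.toℕ<n i)
  ... | second _ _ eq = subst (ℕ._< k) (sym eq) (ℕ.≤-<-trans (ℕ.m∸n≤m (toℕ i) p) (Fin.toℕ<n i))

  leg-injective : ∀ {i j} → side i ≡ side j × index i ≡ index j → i ≡ j
  leg-injective {i} {j} (same-side , same-index) with placement i | placement j
  ... | first _ _ ei  | first _ _ ej  = Fin.toℕ-injective (trans (sym ei) (trans same-index ej))
  ... | second p≤i _ ei | second p≤j _ ej = Fin.toℕ-injective (begin
    toℕ i            ≡⟨ ℕ.m∸n+n≡m p≤i ⟨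
    toℕ i ∸ p ℕ.+ p  ≡⟨ cong (ℕ._+ p) (trans (sym ei) (trans same-index ej)) ⟩
    toℕ j ∸ p ℕ.+ p  ≡⟨ ℕ.m∸n+n≡m p≤j ⟩
    toℕ j            ∎)
    where open ≡-Reasoning
  ... | first _ si _  | second _ sj _ with () ← trans (sym si) (trans same-side sj)
  ... | second _ si _ | first _ sj _  with () ← trans (sym si) (trans same-side sj)

  legs-distinct : ∀ {i j} → i ≢ j → ¬ (side i ≡ side j × index i ≡ index j)
  legs-distinct i≢j = i≢j ∘ leg-injective

  x z : Fin k → ℚ
  x i = C.x (side i) (index i)
  z i = C.z (side i) (index i)

  open SpiderOnStrip x z
  open Counting using (splitAt-injective; remQuot-injective)

  open GoodDrawing
    (λ {i} {j} eq → leg-injective (C.x-injective {side i} {side j} (index<k i) (index<k j) eq))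
    (λ i j → C.x≢x-z {side i} {side j} {index i} {index j} (index<k i) (index<k j))
    (λ {i} {j} eq → leg-injective (C.x-z-injective {side i} {side j} (index<k i) (index<k j) eq))
    (λ i → C.z≢0 (side i) (index<k i))
    (λ {i} {j} i≢j → C.outer-edges-meet {side i} {side j} (legs-distinct i≢j) (index<k i) (index<k j))
    (λ j {a} {b} a≢b → C.no-inner-meets-two-outers (side j) (side a) (side b) {index j} (index<k a) (index<k b) (legs-distinct a≢b))
    (λ {a} {b} {c} a≢b a≢c b≢c → C.no-three-outers-meet (side a) (side b) (side c) (index<k a) (index<k b) (index<k c)
                                   (legs-distinct a≢b) (legs-distinct a≢c) (legs-distinct b≢c))
    public

  on-side : ∀ {i g} → side i ≡ g → x i ≡ C.x g (index i) × z i ≡ C.z g (index i)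
  on-side refl = refl , refl

  earlier-inner-swaps-order : ∀ {i j} → toℕ j ℕ.< toℕ i → SwapOrder j i
  earlier-inner-swaps-order {i} {j} j<i with placement i | placement j
  ... | first _ si ei | first _ sj ej =
    inj₁ (subst (_< 0ℚ) (sym zi≡) (C.z-first<0 (index<k i)) ,
          subst₂ _<_ (sym xj≡) (sym xi≡) (C.x-first-mono (subst₂ ℕ._<_ (sym ej) (sym ei) j<i)))
    where
    xi≡ = proj₁ (on-side si)
    zi≡ = proj₂ (on-side si)
    xj≡ = proj₁ (on-side sj)
  ... | first i<p _ _ | second p≤j _ _ = ⊥-elim (ℕ.<-asym j<i (ℕ.<-≤-trans i<p p≤j))
  ... | second _ si _ | first _ sj _ =
    inj₂ (subst (0ℚ <_) (sym zi≡) (C.0<z-second (index<k i)) ,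
          subst₂ _<_ (sym xi≡) (sym xj≡) (ℚ.<-trans (C.x-second<0 (index<k i)) (C.0<x-first (index<k j))))
    where
    xi≡ = proj₁ (on-side si)
    zi≡ = proj₂ (on-side si)
    xj≡ = proj₁ (on-side sj)
  ... | second p≤i si ei | second p≤j sj ej =
    inj₂ (subst (0ℚ <_) (sym zi≡) (C.0<z-second (index<k i)) ,
          subst₂ _<_ (sym xi≡) (sym xj≡) (C.x-second-anti (subst₂ ℕ._<_ (sym ej) (sym ei) (ℕ.∸-monoˡ-< j<i p≤j))))
    where
    xi≡ = proj₁ (on-side si)
    zi≡ = proj₂ (on-side si)
    xj≡ = proj₁ (on-side sj)

  cross-side-swaps-order : ∀ {i j} → toℕ i ℕ.< p → p ℕ.≤ toℕ j → SwapOrder j i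
  cross-side-swaps-order {i} {j} i<p p≤j with placement i | placement j
  ... | first _ si _ | second _ sj _ =
    inj₁ (subst (_< 0ℚ) (sym (proj₂ (on-side si))) (C.z-first<0 (index<k i)) ,
          subst₂ _<_ (sym (proj₁ (on-side sj))) (sym (proj₁ (on-side si))) (ℚ.<-trans (C.x-second<0 (index<k j)) (C.0<x-first (index<k i))))
  ... | second p≤i _ _ | _ = ⊥-elim (ℕ.<-irrefl refl (ℕ.<-≤-trans i<p p≤i))
  ... | first _ _ _ | first j<p _ _ = ⊥-elim (ℕ.<-irrefl refl (ℕ.<-≤-trans j<p p≤j))

  crossing-of-pair : ∀ i j → i ≢ j → Dec (toℕ i ℕ.< toℕ j) → Crossing drawing
  crossing-of-pair i j _   (yes i<j) = outer-outer-crossing i<j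
  crossing-of-pair i j i≢j (no i≮j)  = inner-outer-crossing (earlier-inner-swaps-order j<i)
    where
    j<i : toℕ j ℕ.< toℕ i
    j<i = ℕ.≤∧≢⇒< (ℕ.≮⇒≥ i≮j) (λ eq → i≢j (Fin.toℕ-injective (sym eq)))

  ordered-pair-crossing : Fin (k ℕ.* k′) → Crossing drawing
  ordered-pair-crossing o = crossing-of-pair i (Fin.punchIn i j′) (Fin.punchInᵢ≢i i j′ ∘ sym) (toℕ i ℕ.<? toℕ (Fin.punchIn i j′))
    where
    i = proj₁ (Fin.remQuot {k} k′ o)
    j′ = proj₂ (Fin.remQuot {k} k′ o)

  q : ℕ
  q = k ∸ p

  first-leg : Fin p → Fin k
  first-leg a = Fin.inject≤ a p≤k

  second-leg : Fin q → Fin k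
  second-leg b = Fin.fromℕ< (subst (p ℕ.+ toℕ b ℕ.<_) (ℕ.m+[n∸m]≡n p≤k) (ℕ.+-monoʳ-< p (Fin.toℕ<n b)))

  toℕ-first-leg : ∀ a → toℕ (first-leg a) ≡ toℕ a
  toℕ-first-leg a = Fin.toℕ-inject≤ a p≤k

  toℕ-second-leg : ∀ b → toℕ (second-leg b) ≡ p ℕ.+ toℕ b
  toℕ-second-leg b = Fin.toℕ-fromℕ< _

  cross-side-crossing : Fin (p ℕ.* q) → Crossing drawing
  cross-side-crossing r = inner-outer-crossing {second-leg b} {first-leg a} (cross-side-swaps-order
    (subst (ℕ._< p) (sym (toℕ-first-leg a)) (Fin.toℕ<n a))
    (subst (p ℕ.≤_) (sym (toℕ-second-leg b)) (ℕ.m≤m+n p (toℕ b))))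
    where
    a = proj₁ (Fin.remQuot {p} q r)
    b = proj₂ (Fin.remQuot {p} q r)

  legs-of : Edge k × Edge k → Fin k × Fin k
  legs-of (outer i , outer j) = i , j
  legs-of (inner j , outer i) = i , j
  legs-of _                   = Fin.zero , Fin.zero

  outer-leg-first : Edge k × Edge k → Bool
  outer-leg-first (inner j , outer i) = does (toℕ i ℕ.<? toℕ j)
  outer-leg-first _                   = false

  legs-of-pair : ∀ i j i≢j d → legs-of (crossingEdges drawing (crossing-of-pair i j i≢j d)) ≡ (i , j)
  legs-of-pair i j i≢j (yes _) = refl
  legs-of-pair i j i≢j (no _)  = refl

  outer-leg-first-pair : ∀ i j i≢j d → outer-leg-first (crossingEdges drawing (crossing-of-pair i j i≢j d)) ≡ false
  outer-leg-first-pair i j i≢j (yes _)  = refl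
  outer-leg-first-pair i j i≢j (no i≮j) = dec-false (toℕ i ℕ.<? toℕ j) i≮j

  outer-leg-first-cross-side : ∀ r → outer-leg-first (crossingEdges drawing (cross-side-crossing r)) ≡ true
  outer-leg-first-cross-side r = dec-true (toℕ (first-leg a) ℕ.<? toℕ (second-leg b))
    (subst₂ ℕ._<_ (sym (toℕ-first-leg a)) (sym (toℕ-second-leg b)) (ℕ.<-≤-trans (Fin.toℕ<n a) (ℕ.m≤m+n p (toℕ b))))
    where
    a = proj₁ (Fin.remQuot {p} q r)
    b = proj₂ (Fin.remQuot {p} q r)

  ordered-pair-crossing-injective : ∀ o o′ →
    crossingEdges drawing (ordered-pair-crossing o) ≡ crossingEdges drawing (ordered-pair-crossing o′) → o ≡ o′
  ordered-pair-crossing-injective o o′ eq = remQuot-injective k′ o o′ (cong₂ _,_ i≡i′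
    (Fin.punchIn-injective i j′ j″ (trans (cong proj₂ legs≡) (cong (λ l → Fin.punchIn l j″) (sym i≡i′)))))
    where
    i = proj₁ (Fin.remQuot {k} k′ o)
    j′ = proj₂ (Fin.remQuot {k} k′ o)
    i′ = proj₁ (Fin.remQuot {k} k′ o′)
    j″ = proj₂ (Fin.remQuot {k} k′ o′)
    legs≡ : (i , Fin.punchIn i j′) ≡ (i′ , Fin.punchIn i′ j″)
    legs≡ = trans (sym (legs-of-pair _ _ _ (toℕ i ℕ.<? toℕ (Fin.punchIn i j′))))
              (trans (cong legs-of eq) (legs-of-pair _ _ _ (toℕ i′ ℕ.<? toℕ (Fin.punchIn i′ j″))))
    i≡i′ = cong proj₁ legs≡

  cross-side-crossing-injective : ∀ r r′ →
    crossingEdges drawing (cross-side-crossing r) ≡ crossingEdges drawing (cross-side-crossing r′) → r ≡ r′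
  cross-side-crossing-injective r r′ eq = remQuot-injective q r r′ (cong₂ _,_ a≡ b≡)
    where
    a = proj₁ (Fin.remQuot {p} q r)
    b = proj₂ (Fin.remQuot {p} q r)
    a′ = proj₁ (Fin.remQuot {p} q r′)
    b′ = proj₂ (Fin.remQuot {p} q r′)
    legs≡ : (first-leg a , second-leg b) ≡ (first-leg a′ , second-leg b′)
    legs≡ = cong legs-of eq
    a≡ : a ≡ a′
    a≡ = Fin.toℕ-injective (trans (sym (toℕ-first-leg a)) (trans (cong (toℕ ∘ proj₁) legs≡) (toℕ-first-leg a′)))
    b≡ : b ≡ b′
    b≡ = Fin.toℕ-injective (ℕ.+-cancelˡ-≡ p _ _
      (trans (sym (toℕ-second-leg b)) (trans (cong (toℕ ∘ proj₂) legs≡) (toℕ-second-leg b′))))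

  outer-leg-first-ordered : ∀ o → outer-leg-first (crossingEdges drawing (ordered-pair-crossing o)) ≡ false
  outer-leg-first-ordered o = outer-leg-first-pair i j _ (toℕ i ℕ.<? toℕ j)
    where
    i = proj₁ (Fin.remQuot {k} k′ o)
    j = Fin.punchIn i (proj₂ (Fin.remQuot {k} k′ o))

  chosen-crossing : Fin (k ℕ.* k′) ⊎ Fin (p ℕ.* q) → Crossing drawing
  chosen-crossing = [ ordered-pair-crossing , cross-side-crossing ]′

  chosen-crossing-injective : ∀ s t → crossingEdges drawing (chosen-crossing s) ≡ crossingEdges drawing (chosen-crossing t) → s ≡ t
  chosen-crossing-injective (inj₁ o) (inj₁ o′) eq = cong inj₁ (ordered-pair-crossing-injective o o′ eq)
  chosen-crossing-injective (inj₂ r) (inj₂ r′) eq = cong inj₂ (cross-side-crossing-injective r r′ eq)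
  chosen-crossing-injective (inj₁ o) (inj₂ r) eq
    with () ← trans (sym (outer-leg-first-ordered o)) (trans (cong outer-leg-first eq) (outer-leg-first-cross-side r))
  chosen-crossing-injective (inj₂ r) (inj₁ o) eq
    with () ← trans (sym (outer-leg-first-cross-side r)) (trans (cong outer-leg-first eq) (outer-leg-first-ordered o))

  many-crossings : HasAtLeastCrossings drawing (k ℕ.* k′ ℕ.+ p ℕ.* q)
  many-crossings = chosen-crossing ∘ Fin.splitAt (k ℕ.* k′) ,
    λ a b eq → splitAt-injective (k ℕ.* k′) a b (chosen-crossing-injective (Fin.splitAt (k ℕ.* k′) a) (Fin.splitAt (k ℕ.* k′) b) eq)

open import Data.Nat.Base using (_+_; _*_; _≤_)

at-least-crossings-mono : ∀ {k} {D : RectDrawing k} {m n} → m ≤ n → HasAtLeastCrossings D n → HasAtLeastCrossings D m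
at-least-crossings-mono m≤n (crossing , distinct) =
  crossing ∘ (λ a → Fin.inject≤ a m≤n) , λ a b eq → Fin.inject≤-injective m≤n m≤n a b (distinct _ _ eq)

theorem2 : ∀ (k : ℕ) → 3 ≤ k → MaxRectCrossing k (formula k)
theorem2 (suc k′) _ = drawing , at-least-crossings-mono {D = drawing} formula≤ many-crossings , UpperBound.crossings≤formula
  where
  k = suc k′
  open TwoSidedSpider k′ ⌊ k /2⌋ (ℕ.⌊n/2⌋≤n k)
  formula≤ : formula k ≤ k * k′ + ⌊ k /2⌋ * (k ∸ ⌊ k /2⌋)
  formula≤ = subst (_≤ k * k′ + ⌊ k /2⌋ * (k ∸ ⌊ k /2⌋)) (sym (Arithmetic.formula≡k*[k∸1]+k²/4 k))
    (ℕ.+-monoʳ-≤ (k * k′) (Arithmetic.k²/4≤⌊k/2⌋*[k∸⌊k/2⌋] k))
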